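{- Topological search is correct: when an arc $(v,w)$ with $\mathit{position}(v)>\mathit{position}(w)$ is added to an acyclic graph whose vertex numbering is topological, the cycle test reports a cycle if and only if the addition of $(v,w)$ creates one; and if it does not, the reordering step terminates and produces a numbering (a bijection from the vertices to $\{1,\dots,n\}$) that is topological for the graph including $(v,w)$.
   Context: The vertices are numbered by a bijection $\mathit{position}$ onto $\{1,\dots,n\}$ with inverse array $\mathit{vertex}$; the numbering is topological if every arc $(x,y)$ has $\mathit{position}(x)<\mathit{position}(y)$. Arcs are tested in $\mathrm{O}(1)$ time via an adjacency matrix. Queues support inject (add at back) and pop (remove and return front, null if empty). Topological search for new arc $(v,w)$: $F=[w]$, $B=[v]$, $i=\mathit{position}(w)$, $j=\mathit{position}(v)$, set $\mathit{vertex}(i)=\mathit{vertex}(j)=$ null. Repeat: $i=i+1$; while $i<j$ and no $u\in F$ has an arc $(u,\mathit{vertex}(i))$, set $i=i+1$; if $i=j$ stop; else inject $\mathit{vertex}(i)$ into $F$ and set $\mathit{vertex}(i)=$ null. Then $j=j-1$; while $i<j$ and no $z\in B$ has an arc $(\mathit{vertex}(j),z)$, set $j=j-1$; if $i=j$ stop; else inject $\mathit{vertex}(j)$ into $B$ and set $\mathit{vertex}(j)=$ null. Cycle test: after the search, report a cycle iff there is an arc $(u,z)$ with $u\in F$, $z\in B$. Reordering (if no cycle), starting from the final values of $F,B,i,j$: while $F$ is nonempty: if $\mathit{vertex}(i)\ne$ null and some $u$ currently in $F$ has an arc $(u,\mathit{vertex}(i))$, inject $\mathit{vertex}(i)$ into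 $F$ and set $\mathit{vertex}(i)=$ null; if $\mathit{vertex}(i)=$ null, pop $x$ from $F$ and set $\mathit{vertex}(i)=x$, $\mathit{position}(x)=i$; then $i=i+1$. While $B$ is nonempty: $j=j-1$; if $\mathit{vertex}(j)\ne$ null and there is an arc $(\mathit{vertex}(j),z)$ with $z$ currently in $B$, inject $\mathit{vertex}(j)$ into $B$ and set $\mathit{vertex}(j)=$ null; if $\mathit{vertex}(j)=$ null, pop $y$ from $B$ and set $\mathit{vertex}(j)=y$, $\mathit{position}(y)=j$. -}

module Defs where

open import Data.Nat using (ℕ; zero; suc; _+_; _∸_; _≤_; _<_; _≡ᵇ_; _<ᵇ_)
open import Data.Fin using (Fin; _≟_)
open import Data.Bool using (Bool; true; false; _∧_; _∨_; not; if_then_else_)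
open import Data.List using (List; []; _∷_; _++_)
open import Data.Bool.ListAction using (any)
open import Data.Maybe using (Maybe; just; nothing)
open import Data.Product using (Σ; ∃; ∃-syntax; _×_; _,_)
open import Relation.Nullary using (¬_; does)
open import Relation.Binary.PropositionalEquality using (_≡_)
open import Relation.Binary.Construct.Closure.Transitive using (TransClosure)

Adj : ℕ → Set
Adj n = Fin n → Fin n → Bool

Arc : ∀ {n} → Adj n → Fin n → Fin n → Set
Arc A x y = A x y ≡ true

Cyclic : ∀ {n} → Adj n → Set
Cyclic A = ∃[ x ] TransClosure (Arc A) x x

Acyclic : ∀ {n} → Adj n → Set
Acyclic A = ¬ Cyclic A

addArc : ∀ {n} → Adj n → Fin n → Fin n → Adj n
addArc A v w x y = A x y ∨ (does (x ≟ v) ∧ does (y ≟ w))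

-- Numberings.  Positions are natural numbers; the array 'vertex' is a
-- function ℕ → Maybe (Fin n) ('nothing' = null / outside the array).

IsNumbering : (n : ℕ) → (Fin n → ℕ) → (ℕ → Maybe (Fin n)) → Set
IsNumbering n position vertex =
  (∀ x → 1 ≤ position x × position x ≤ n) ×
  (∀ k → 1 ≤ k → k ≤ n → ∃[ x ] position x ≡ k) ×
  (∀ x y → position x ≡ position y → x ≡ y) ×
  (∀ k x → (vertex k ≡ just x → position x ≡ k) × (position x ≡ k → vertex k ≡ just x))

Topological : ∀ {n} → Adj n → (Fin n → ℕ) → Set
Topological A position = ∀ x y → Arc A x y → position x < position y

record St (n : ℕ) : Set where
  constructor st
  field
    F B      : List (Fin n)
    i j      : ℕ
    vertex   : ℕ → Maybe (Fin n)
    position : Fin n → ℕ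
open St public

module Algorithm {n : ℕ} (A : Adj n) where

  inject : Fin n → List (Fin n) → List (Fin n)
  inject x q = q ++ (x ∷ [])

  setVertex : ℕ → Maybe (Fin n) → (ℕ → Maybe (Fin n)) → (ℕ → Maybe (Fin n))
  setVertex k m vx k' = if k' ≡ᵇ k then m else vx k'

  setPosition : Fin n → ℕ → (Fin n → ℕ) → (Fin n → ℕ)
  setPosition x k p y = if does (y ≟ x) then k else p y

  arcFrom : List (Fin n) → Fin n → Bool
  arcFrom q y = any (λ u → A u y) q

  arcTo : Fin n → List (Fin n) → Bool
  arcTo y q = any (λ z → A y z) q

  testF : St n → ℕ → Bool
  testF s k with vertex s k
  ... | nothing = false
  ... | just y  = arcFrom (F s) y

  testB : St n → ℕ → Bool
  testB s k with vertex s k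
  ... | nothing = false
  ... | just y  = arcTo y (B s)

  moveToF : ℕ → St n → St n
  moveToF k s with vertex s k
  ... | nothing = record s { vertex = setVertex k nothing (vertex s) }
  ... | just y  = record s { F = inject y (F s) ; vertex = setVertex k nothing (vertex s) }

  moveToB : ℕ → St n → St n
  moveToB k s with vertex s k
  ... | nothing = record s { vertex = setVertex k nothing (vertex s) }
  ... | just y  = record s { B = inject y (B s) ; vertex = setVertex k nothing (vertex s) }

  isNull : Maybe (Fin n) → Bool
  isNull nothing  = true
  isNull (just _) = false

  -- Topological search, with fuel (every step consumes one unit;
  -- 'nothing' means the fuel ran out).

  initial : Fin n → Fin n → (Fin n → ℕ) → (ℕ → Maybe (Fin n)) → St n
  initial v w p vx =
    st (w ∷ []) (v ∷ []) (p w) (p v)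
       (setVertex (p w) nothing (setVertex (p v) nothing vx)) p

  mutual
    -- top of the 'repeat' loop: i = i + 1
    searchLoop : ℕ → St n → Maybe (St n)
    searchLoop zero    s = nothing
    searchLoop (suc f) s = whileI f (record s { i = suc (i s) })

    whileI : ℕ → St n → Maybe (St n)
    whileI zero    s = nothing
    whileI (suc f) s =
      if (i s <ᵇ j s) ∧ not (testF s (i s))
      then whileI f (record s { i = suc (i s) })
      else afterI f s

    afterI : ℕ → St n → Maybe (St n)
    afterI zero    s = nothing
    afterI (suc f) s =
      if i s ≡ᵇ j s
      then just s
      else whileJ f (record (moveToF (i s) s) { j = j s ∸ 1 })

    whileJ : ℕ → St n → Maybe (St n)
    whileJ zero    s = nothing
    whileJ (suc f) s =
      if (i s <ᵇ j s) ∧ not (testB s (j s))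
      then whileJ f (record s { j = j s ∸ 1 })
      else afterJ f s

    afterJ : ℕ → St n → Maybe (St n)
    afterJ zero    s = nothing
    afterJ (suc f) s =
      if i s ≡ᵇ j s
      then just s
      else searchLoop f (moveToB (j s) s)

  search : ℕ → Fin n → Fin n → (Fin n → ℕ) → (ℕ → Maybe (Fin n)) → Maybe (St n)
  search f v w p vx = searchLoop f (initial v w p vx)

  cycleTest : St n → Bool
  cycleTest s = any (λ u → arcTo u (B s)) (F s)

  stepF : St n → St n
  stepF s = record s3 { i = suc (i s3) }
    where
    s1 : St n
    s1 = if testF s (i s) then moveToF (i s) s else s
    popF : St n → St n
    popF t with F t
    ... | []     = t
    ... | x ∷ q  = record t { F = q ; vertex = setVertex (i t) (just x) (vertex t)
                            ; position = setPosition x (i t) (position t) }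
    s3 : St n
    s3 = if isNull (vertex s1 (i s1)) then popF s1 else s1

  stepB : St n → St n
  stepB s = s3
    where
    s0 : St n
    s0 = record s { j = j s ∸ 1 }
    s1 : St n
    s1 = if testB s0 (j s0) then moveToB (j s0) s0 else s0
    popB : St n → St n
    popB t with B t
    ... | []     = t
    ... | y ∷ q  = record t { B = q ; vertex = setVertex (j t) (just y) (vertex t)
                            ; position = setPosition y (j t) (position t) }
    s3 : St n
    s3 = if isNull (vertex s1 (j s1)) then popB s1 else s1

  loopB : ℕ → St n → Maybe (St n)
  loopB zero    s = nothing
  loopB (suc f) s with B s
  ... | []    = just s
  ... | _ ∷ _ = loopB f (stepB s)

  loopF : ℕ → St n → Maybe (St n)
  loopF zero    s = nothing
  loopF (suc f) s with F s
  ... | []    = loopB f s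
  ... | _ ∷ _ = loopF f (stepF s)

  reorder : ℕ → St n → Maybe (St n)
  reorder = loopF

-- Both phases of the algorithm are analysed by loop invariants; every
-- loop is shown to terminate by induction on a distance, which also
-- provides the fuel for the fuelled definitions of the algorithm.
--
-- With scan bounds lo ≤ hi, the queue F holds the
-- vertices of initial position below lo that are reachable from w, sorted
-- by position, and B those of position at least hi that reach v, sorted
-- downwards; the slots in between are untouched, and the null slots on
-- either side are exactly as many as the queue elements.  The scans stop
-- when the bounds meet.  Then an arc from F to B closes a cycle
-- w ⇝ u → z ⇝ v → w, so a positive cycle test is sound.
--
-- The F-loop fills the null slots
-- from the meeting point m upwards, the B-loop those below m downwards.
-- The invariants keep array and positions mutually inverse and give, for
-- every arc (x , y), a reason why x will end up before y; once both queues
-- are empty the reason reduces to "position x < position y".  So a negative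
-- cycle test leads to a topological numbering, which excludes cycles.
module Submission where

open import Defs
open import Data.Nat using (ℕ; _<_)
open import Data.Fin using (Fin)
open import Data.Bool using (Bool; true)
open import Data.Maybe using (Maybe; just)
open import Data.Product using (Σ; ∃; ∃-syntax; _×_)
open import Relation.Nullary using (¬_)
open import Relation.Binary.PropositionalEquality using (_≡_)
open import Function.Bundles using (_⇔_)

open import Data.Nat using (zero; suc; _+_; _∸_; _≤_; z≤n; s≤s; z<s; _≡ᵇ_; _<ᵇ_)
open import Data.Nat.Properties
open import Data.Fin using () renaming (_≟_ to _≟F_)
open import Data.Bool using (false)
open import Data.Bool.Properties using (T-≡)
open import Data.Bool.ListAction using (any)
open import Data.List using (List; []; _∷_; _++_; length)
open import Data.List.Properties using (length-++)
open import Data.List.Relation.Unary.Any using (here; there)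
open import Data.List.Relation.Unary.Any.Properties using (any⁺; any⁻)
import Data.List.Relation.Unary.Any as Any
import Data.List.Relation.Unary.All as All
import Data.List.Relation.Unary.AllPairs as AllPairs
open import Data.List.Relation.Unary.AllPairs using (AllPairs; []; _∷_)
import Data.List.Relation.Unary.AllPairs.Properties as AllPairsₚ
open import Data.List.Relation.Unary.Unique.Propositional using (Unique)
open import Data.List.Membership.Propositional using (_∈_; _∉_; find)
open import Data.List.Membership.Propositional.Properties using (∈-++⁺ˡ; ∈-++⁺ʳ; ∈-++⁻)
import Data.List.Membership.DecPropositional as DecMembership
open import Data.Maybe using (nothing)
open import Data.Maybe.Properties using (just-injective)
open import Data.Product using (∃₂; _,_; proj₁; proj₂)
open import Data.Sum using (_⊎_; inj₁; inj₂; [_,_]′)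
open import Function.Base using (_∘_)
open import Data.Empty using (⊥; ⊥-elim)
open import Relation.Nullary using (Dec; yes; no)
open import Relation.Binary.PropositionalEquality using (refl; sym; trans; cong; cong₂; subst; subst₂; module ≡-Reasoning)
open import Relation.Binary.Construct.Closure.ReflexiveTransitive using (Star; ε; _◅_; _◅◅_)
open import Relation.Binary.Construct.Closure.Transitive using (TransClosure; [_]; _∷_)
open import Function.Bundles using (mk⇔; Equivalence)

≡ᵇ-refl : ∀ k → (k ≡ᵇ k) ≡ true
≡ᵇ-refl k = Equivalence.to T-≡ (≡⇒≡ᵇ k k refl)

≢⇒≡ᵇ-false : ∀ {k l} → ¬ k ≡ l → (k ≡ᵇ l) ≡ false
≢⇒≡ᵇ-false {k} {l} k≢l with k ≡ᵇ l in eq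
... | true  = ⊥-elim (k≢l (≡ᵇ⇒≡ k l (Equivalence.from T-≡ eq)))
... | false = refl

<⇒<ᵇ-true : ∀ {k l} → k < l → (k <ᵇ l) ≡ true
<⇒<ᵇ-true k<l = Equivalence.to T-≡ (<⇒<ᵇ k<l)

<ᵇ-irrefl : ∀ k → (k <ᵇ k) ≡ false
<ᵇ-irrefl zero    = refl
<ᵇ-irrefl (suc k) = <ᵇ-irrefl k

suc-∸1 : ∀ {i j} → i < j → suc (j ∸ 1) ≡ j
suc-∸1 {j = suc j} _ = refl

true≢false : ¬ true ≡ false
true≢false ()

module _ {X : Set} where

  any-true : (f : X → Bool) (xs : List X) → any f xs ≡ true → ∃[ x ] (x ∈ xs × f x ≡ true)
  any-true f xs e with find (any⁻ f xs (Equivalence.from T-≡ e))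
  ... | x , x∈xs , fx = x , x∈xs , Equivalence.to T-≡ fx

  any-intro : (f : X → Bool) (xs : List X) → ∀ {x} → x ∈ xs → f x ≡ true → any f xs ≡ true
  any-intro f xs x∈xs fx =
    Equivalence.to T-≡ (any⁺ f (Any.map (λ { refl → Equivalence.from T-≡ fx }) x∈xs))

  any-false : (f : X → Bool) (xs : List X) → any f xs ≡ false → ∀ {x} → x ∈ xs → ¬ f x ≡ true
  any-false f xs none x∈xs fx = true≢false (trans (sym (any-intro f xs x∈xs fx)) none)

  ∈-snoc⁻ : ∀ {xs : List X} {x} z → x ∈ xs ++ z ∷ [] → x ∈ xs ⊎ x ≡ z
  ∈-snoc⁻ {xs} z x∈ with ∈-++⁻ xs x∈
  ... | inj₁ x∈xs        = inj₁ x∈xs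
  ... | inj₂ (here x≡z) = inj₂ x≡z

  ∈-snoc-last : ∀ (xs : List X) z → z ∈ xs ++ z ∷ []
  ∈-snoc-last xs z = ∈-++⁺ʳ xs (here refl)

  length-snoc : ∀ xs (z : X) → length (xs ++ z ∷ []) ≡ suc (length xs)
  length-snoc xs z = trans (length-++ xs) (+-comm (length xs) 1)

  allPairs-snoc : ∀ {R : X → X → Set} {xs} z → AllPairs R xs → (∀ {x} → x ∈ xs → R x z) →
                  AllPairs R (xs ++ z ∷ [])
  allPairs-snoc z Rxs Rz = AllPairsₚ.++⁺ Rxs (All.[] ∷ []) (All.tabulate (λ x∈ → Rz x∈ All.∷ All.[]))

  -- 'Precedes xs x y': x occurs in xs strictly before an occurrence of y.
  -- Queues are processed front to back, so this is the order in which
  -- the reordering phase will place their elements.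

  Precedes : List X → X → X → Set
  Precedes xs x y = ∃₂ λ pre suf → xs ≡ pre ++ x ∷ suf × y ∈ suf

  Precedes-∈ˡ : ∀ {xs x y} → Precedes xs x y → x ∈ xs
  Precedes-∈ˡ (pre , suf , refl , _) = ∈-++⁺ʳ pre (here refl)

  Precedes-∈ʳ : ∀ {xs x y} → Precedes xs x y → y ∈ xs
  Precedes-∈ʳ (pre , suf , refl , y∈) = ∈-++⁺ʳ pre (there y∈)

  Precedes-head : ∀ {f q y} → y ∈ q → Precedes (f ∷ q) f y
  Precedes-head y∈q = [] , _ , refl , y∈q

  Precedes-cons : ∀ {f q x y} → Precedes q x y → Precedes (f ∷ q) x y
  Precedes-cons {f} (pre , suf , refl , y∈) = f ∷ pre , suf , refl , y∈

  Precedes-tail : ∀ {f q x y} → Precedes (f ∷ q) x y → ¬ x ≡ f → Precedes q x y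
  Precedes-tail ([] , suf , refl , _) x≢f = ⊥-elim (x≢f refl)
  Precedes-tail (_ ∷ pre , suf , refl , y∈) _ = pre , suf , refl , y∈

  Precedes-snoc : ∀ {q x y} z → Precedes q x y → Precedes (q ++ z ∷ []) x y
  Precedes-snoc {x = x} z (pre , suf , refl , y∈) =
    pre , suf ++ z ∷ [] , reassoc pre , ∈-++⁺ˡ y∈
    where
    reassoc : ∀ {suf} pre → (pre ++ x ∷ suf) ++ z ∷ [] ≡ pre ++ x ∷ (suf ++ z ∷ [])
    reassoc []        = refl
    reassoc (a ∷ pre) = cong (a ∷_) (reassoc pre)

  Precedes-last : ∀ {q : List X} {x} z → x ∈ q → Precedes (q ++ z ∷ []) x z
  Precedes-last z (here {xs = q} refl) = [] , q ++ z ∷ [] , refl , ∈-snoc-last q z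
  Precedes-last z (there x∈)           = Precedes-cons (Precedes-last z x∈)

  Precedes-trichotomy : ∀ {xs x y} → x ∈ xs → y ∈ xs → x ≡ y ⊎ Precedes xs x y ⊎ Precedes xs y x
  Precedes-trichotomy (here refl) (here refl) = inj₁ refl
  Precedes-trichotomy (here refl) (there y∈)  = inj₂ (inj₁ (Precedes-head y∈))
  Precedes-trichotomy (there x∈)  (here refl) = inj₂ (inj₂ (Precedes-head x∈))
  Precedes-trichotomy (there x∈)  (there y∈) with Precedes-trichotomy x∈ y∈
  ... | inj₁ x≡y        = inj₁ x≡y
  ... | inj₂ (inj₁ x≺y) = inj₂ (inj₁ (Precedes-cons x≺y))
  ... | inj₂ (inj₂ y≺x) = inj₂ (inj₂ (Precedes-cons y≺x))

  AllPairs-Precedes : ∀ {R : X → X → Set} {xs x y} → AllPairs R xs → Precedes xs x y → R x y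
  AllPairs-Precedes (Rx ∷ _)  ([] , suf , refl , y∈)      = All.lookup Rx y∈
  AllPairs-Precedes (_ ∷ Rxs) (_ ∷ pre , suf , refl , y∈) = AllPairs-Precedes Rxs (pre , suf , refl , y∈)

  Unique-head : ∀ {f : X} {q} → Unique (f ∷ q) → f ∉ q
  Unique-head (f≢q ∷ _) f∈q = All.lookup f≢q f∈q refl

  Precedes-head-tail : ∀ {f : X} {q y} → Unique (f ∷ q) → Precedes (f ∷ q) f y → y ∈ q
  Precedes-head-tail u f≺y with Precedes-∈ʳ f≺y
  ... | here refl = ⊥-elim (AllPairs-Precedes u f≺y refl)
  ... | there y∈q = y∈q

path-then-arc : ∀ {X : Set} {R : X → X → Set} {x y z} → Star R x y → R y z → TransClosure R x z
path-then-arc ε        y→z = [ y→z ]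
path-then-arc (e ◅ es) y→z = e ∷ path-then-arc es y→z

-- A graph with a topological numbering has no cycle: positions strictly
-- increase along every nonempty path.
topological⇒acyclic : ∀ {n} (G : Adj n) (pos : Fin n → ℕ) → Topological G pos → ¬ Cyclic G
topological⇒acyclic G pos topo (x , cycle) = <-irrefl refl (increasing cycle)
  where
  increasing : ∀ {x y} → TransClosure (Arc G) x y → pos x < pos y
  increasing [ e ]    = topo _ _ e
  increasing (e ∷ es) = <-trans (topo _ _ e) (increasing es)

-- 'nulls vt lo d' counts the null slots of the array vt in [lo , lo + d).
-- The search and reordering invariants equate such counts with queue
-- lengths; this is what bounds the loops and shows that the array is
-- completely filled at the end.

null? : ∀ {X : Set} → Maybe X → ℕ
null? nothing  = 1
null? (just _) = 0

nulls : ∀ {X : Set} → (ℕ → Maybe X) → ℕ → ℕ → ℕ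
nulls vt lo zero    = 0
nulls vt lo (suc d) = null? (vt lo) + nulls vt (suc lo) d

module _ {X : Set} where

  nulls-snoc : ∀ (vt : ℕ → Maybe X) lo d → nulls vt lo (suc d) ≡ nulls vt lo d + null? (vt (lo + d))
  nulls-snoc vt lo zero    rewrite +-identityʳ lo = +-comm (null? (vt lo)) 0
  nulls-snoc vt lo (suc d) rewrite nulls-snoc vt (suc lo) d | +-suc lo d =
    sym (+-assoc (null? (vt lo)) _ _)

  nulls-ext : ∀ (vt vt′ : ℕ → Maybe X) lo d → (∀ k → lo ≤ k → k < lo + d → vt k ≡ vt′ k) →
              nulls vt lo d ≡ nulls vt′ lo d
  nulls-ext vt vt′ lo zero    _  = refl
  nulls-ext vt vt′ lo (suc d) eq =
    cong₂ _+_ (cong null? (eq lo ≤-refl (m<m+n lo z<s)))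
              (nulls-ext vt vt′ (suc lo) d (λ k lo<k k< → eq k (<⇒≤ lo<k) (subst (k <_) (sym (+-suc lo d)) k<)))

  nulls-zero : ∀ (vt : ℕ → Maybe X) lo d → nulls vt lo d ≡ 0 → ∀ k → lo ≤ k → k < lo + d → ∃[ x ] vt k ≡ just x
  nulls-zero vt lo zero    _ k lo≤k k< = ⊥-elim (<-irrefl refl (≤-trans k< (subst (_≤ k) (sym (+-identityʳ lo)) lo≤k)))
  nulls-zero vt lo (suc d) e k lo≤k k< with vt lo in eq
  nulls-zero vt lo (suc d) () k lo≤k k< | nothing
  ... | just x with k ≟ lo
  ... | yes refl = x , eq
  ... | no k≢lo  = nulls-zero vt (suc lo) d e k (≤∧≢⇒< lo≤k (λ q → k≢lo (sym q))) (subst (k <_) (+-suc lo d) k<)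

  nulls-full : ∀ (vt : ℕ → Maybe X) lo d → (∀ k → lo ≤ k → k < lo + d → ∃[ x ] vt k ≡ just x) → nulls vt lo d ≡ 0
  nulls-full vt lo zero    _    = refl
  nulls-full vt lo (suc d) full with full lo ≤-refl (m<m+n lo z<s)
  ... | x , eq rewrite eq =
    nulls-full vt (suc lo) d (λ k lo<k k< → full k (<⇒≤ lo<k) (subst (k <_) (sym (+-suc lo d)) k<))

-- One-step unfolding equations of the algorithm, for an arbitrary graph G.
-- They are stated for states written out as 'st F B i j vt ps', so that the
-- correctness proofs never have to look inside the fuelled definitions.
module Unfolding {n : ℕ} (G : Adj n) where
  open Algorithm G

  testF-just : ∀ F B i j vt ps k y → vt k ≡ just y → testF (st F B i j vt ps) k ≡ arcFrom F y
  testF-just F B i j vt ps k y eq rewrite eq = refl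

  testF-nothing : ∀ F B i j vt ps k → vt k ≡ nothing → testF (st F B i j vt ps) k ≡ false
  testF-nothing F B i j vt ps k eq rewrite eq = refl

  testB-just : ∀ F B i j vt ps k y → vt k ≡ just y → testB (st F B i j vt ps) k ≡ arcTo y B
  testB-just F B i j vt ps k y eq rewrite eq = refl

  whileI-skip : ∀ f F B i j vt ps y → i < j → vt i ≡ just y → arcFrom F y ≡ false →
    whileI (suc f) (st F B i j vt ps) ≡ whileI f (st F B (suc i) j vt ps)
  whileI-skip f F B i j vt ps y i<j vti noArc
    rewrite testF-just F B i j vt ps i y vti | noArc | <⇒<ᵇ-true i<j = refl

  whileI-met : ∀ F B i vt ps → whileI 2 (st F B i i vt ps) ≡ just (st F B i i vt ps)
  whileI-met F B i vt ps rewrite <ᵇ-irrefl i | ≡ᵇ-refl i = refl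

  whileI-inject : ∀ f F B i j vt ps y → i < j → vt i ≡ just y → arcFrom F y ≡ true →
    whileI (suc (suc f)) (st F B i j vt ps)
      ≡ whileJ f (st (F ++ y ∷ []) B i (j ∸ 1) (setVertex i nothing vt) ps)
  whileI-inject f F B i j vt ps y i<j vti arc
    rewrite testF-just F B i j vt ps i y vti | arc | ≢⇒≡ᵇ-false (<⇒≢ i<j) | vti
    with i <ᵇ j   -- the loop condition is false either way
  ... | true  = refl
  ... | false = refl

  whileJ-skip : ∀ f F B i j vt ps y → i < j → vt j ≡ just y → arcTo y B ≡ false →
    whileJ (suc f) (st F B i j vt ps) ≡ whileJ f (st F B i (j ∸ 1) vt ps)
  whileJ-skip f F B i j vt ps y i<j vtj noArc
    rewrite testB-just F B i j vt ps j y vtj | noArc | <⇒<ᵇ-true i<j = refl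

  whileJ-met : ∀ F B i vt ps → whileJ 2 (st F B i i vt ps) ≡ just (st F B i i vt ps)
  whileJ-met F B i vt ps rewrite <ᵇ-irrefl i | ≡ᵇ-refl i = refl

  whileJ-inject : ∀ f F B i j vt ps y → i < j → vt j ≡ just y → arcTo y B ≡ true →
    whileJ (suc (suc (suc f))) (st F B i j vt ps)
      ≡ whileI f (st F (B ++ y ∷ []) (suc i) j (setVertex j nothing vt) ps)
  whileJ-inject f F B i j vt ps y i<j vtj arc
    rewrite testB-just F B i j vt ps j y vtj | arc | ≢⇒≡ᵇ-false (<⇒≢ i<j) | vtj
    with i <ᵇ j   -- the loop condition is false either way
  ... | true  = refl
  ... | false = refl

  -- The reordering: the state equations are stated on the tuple of fields,
  -- since the loop bodies are defined through local helper functions.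

  fields : St n → List (Fin n) × List (Fin n) × ℕ × ℕ × (ℕ → Maybe (Fin n)) × (Fin n → ℕ)
  fields s = (F s , B s , i s , j s , vertex s , position s)

  St-ext : ∀ {s t : St n} → fields s ≡ fields t → s ≡ t
  St-ext refl = refl

  stepF-pop : ∀ f F B i j vt ps → vt i ≡ nothing →
    fields (stepF (st (f ∷ F) B i j vt ps))
      ≡ fields (st F B (suc i) j (setVertex i (just f) vt) (setPosition f i ps))
  stepF-pop f F B i j vt ps e with testF (st (f ∷ F) B i j vt ps) i in eqT
  ... | true = ⊥-elim (true≢false (trans (sym eqT) (testF-nothing (f ∷ F) B i j vt ps i e)))
  ... | false with vt i | e
  ... | .nothing | refl = refl

  stepF-inject : ∀ f F B i j vt ps y → vt i ≡ just y → arcFrom (f ∷ F) y ≡ true →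
    fields (stepF (st (f ∷ F) B i j vt ps))
      ≡ fields (st (F ++ y ∷ []) B (suc i) j (setVertex i (just f) (setVertex i nothing vt)) (setPosition f i ps))
  stepF-inject f F B i j vt ps y e arc with testF (st (f ∷ F) B i j vt ps) i in eqT
  ... | false = ⊥-elim (true≢false (trans (sym (trans (testF-just (f ∷ F) B i j vt ps i y e) arc)) eqT))
  ... | true with vt i | e
  ... | .(just y) | refl rewrite ≡ᵇ-refl i = refl

  stepF-skip : ∀ f F B i j vt ps y → vt i ≡ just y → arcFrom (f ∷ F) y ≡ false →
    fields (stepF (st (f ∷ F) B i j vt ps)) ≡ fields (st (f ∷ F) B (suc i) j vt ps)
  stepF-skip f F B i j vt ps y e noArc with testF (st (f ∷ F) B i j vt ps) i in eqT
  ... | true = ⊥-elim (true≢false (trans (sym eqT) (trans (testF-just (f ∷ F) B i j vt ps i y e) noArc)))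
  ... | false with vt i | e
  ... | .(just y) | refl = refl

  stepB-pop : ∀ b B F i j vt ps → vt (j ∸ 1) ≡ nothing →
    fields (stepB (st F (b ∷ B) i j vt ps))
      ≡ fields (st F B i (j ∸ 1) (setVertex (j ∸ 1) (just b) vt) (setPosition b (j ∸ 1) ps))
  stepB-pop b B F i j vt ps e rewrite e | e = refl

  stepB-inject : ∀ b B F i j vt ps y → vt (j ∸ 1) ≡ just y → arcTo y (b ∷ B) ≡ true →
    fields (stepB (st F (b ∷ B) i j vt ps))
      ≡ fields (st F (B ++ y ∷ []) i (j ∸ 1) (setVertex (j ∸ 1) (just b) (setVertex (j ∸ 1) nothing vt)) (setPosition b (j ∸ 1) ps))
  stepB-inject b B F i j vt ps y e arc rewrite e | arc | ≡ᵇ-refl (j ∸ 1) = refl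

  stepB-skip : ∀ b B F i j vt ps y → vt (j ∸ 1) ≡ just y → arcTo y (b ∷ B) ≡ false →
    fields (stepB (st F (b ∷ B) i j vt ps)) ≡ fields (st F (b ∷ B) i (j ∸ 1) vt ps)
  stepB-skip b B F i j vt ps y e noArc rewrite e | noArc | e = refl

  setVertex-here : ∀ k (mx : Maybe (Fin n)) vt → setVertex k mx vt k ≡ mx
  setVertex-here k mx vt rewrite ≡ᵇ-refl k = refl

  setVertex-elsewhere : ∀ k (mx : Maybe (Fin n)) vt k′ → ¬ k′ ≡ k → setVertex k mx vt k′ ≡ vt k′
  setVertex-elsewhere k mx vt k′ k′≢k rewrite ≢⇒≡ᵇ-false k′≢k = refl

  setPosition-here : ∀ x k ps → setPosition x k ps x ≡ k
  setPosition-here x k ps with x ≟F x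
  ... | yes _  = refl
  ... | no x≢x = ⊥-elim (x≢x refl)

  setPosition-elsewhere : ∀ x k ps y → ¬ y ≡ x → setPosition x k ps y ≡ ps y
  setPosition-elsewhere x k ps y y≢x with y ≟F x
  ... | yes y≡x = ⊥-elim (y≢x y≡x)
  ... | no _    = refl

  -- Deciding equality of vertices; a separate function, so that a case
  -- split on it does not abstract the tests inside setPosition.
  _≟V_ : (x y : Fin n) → Dec (x ≡ y)
  x ≟V y with x ≟F y
  ... | yes x≡y = yes x≡y
  ... | no x≢y  = no x≢y

  just≢nothing : ∀ {x : Fin n} → ¬ just x ≡ nothing
  just≢nothing ()

module Correctness {n : ℕ} (A : Adj n) (v w : Fin n) (p : Fin n → ℕ) (vx : ℕ → Maybe (Fin n))
                   (isN : IsNumbering n p vx) (topo : Topological A p) (wv : p w < p v) where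
  G : Adj n
  G = addArc A v w
  open Algorithm G public
  open Unfolding G public

  pw pv : ℕ
  pw = p w
  pv = p v

  p-range : ∀ x → 1 ≤ p x × p x ≤ n
  p-range = proj₁ isN

  p-inj : ∀ x y → p x ≡ p y → x ≡ y
  p-inj = proj₁ (proj₂ (proj₂ isN))

  vx⇒p : ∀ k x → vx k ≡ just x → p x ≡ k
  vx⇒p k x = proj₁ (proj₂ (proj₂ (proj₂ isN)) k x)

  p⇒vx : ∀ x → vx (p x) ≡ just x
  p⇒vx x = proj₂ (proj₂ (proj₂ (proj₂ isN)) (p x) x) refl

  vx-full : ∀ k → 1 ≤ k → k ≤ n → ∃[ x ] vx k ≡ just x
  vx-full k 1≤k k≤n with proj₁ (proj₂ isN) k 1≤k k≤n
  ... | x , refl = x , p⇒vx x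

  v≢w : ¬ v ≡ w
  v≢w refl = <-irrefl refl wv

  arc-cases : ∀ {x y} → Arc G x y → Arc A x y ⊎ (x ≡ v × y ≡ w)
  arc-cases {x} {y} e with A x y | x ≟F v | y ≟F w
  ... | true  | _        | _        = inj₁ refl
  ... | false | yes refl | yes refl = inj₂ (refl , refl)
  ... | false | yes _    | no _     = ⊥-elim (true≢false (sym e))
  ... | false | no _     | _        = ⊥-elim (true≢false (sym e))

  arc-vw : Arc G v w
  arc-vw with A v w | v ≟F v | w ≟F w
  ... | true  | _      | _      = refl
  ... | false | yes _  | yes _  = refl
  ... | false | no v≢v | _      = ⊥-elim (v≢v refl)
  ... | false | yes _  | no w≢w = ⊥-elim (w≢w refl)

  p-mono-¬v : ∀ {x y} → Arc G x y → ¬ x ≡ v → p x < p y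
  p-mono-¬v e x≢v with arc-cases e
  ... | inj₁ old        = topo _ _ old
  ... | inj₂ (refl , _) = ⊥-elim (x≢v refl)

  p-mono-¬w : ∀ {x y} → Arc G x y → ¬ y ≡ w → p x < p y
  p-mono-¬w e y≢w with arc-cases e
  ... | inj₁ old        = topo _ _ old
  ... | inj₂ (_ , refl) = ⊥-elim (y≢w refl)

  arc-irrefl : ∀ {x} → ¬ Arc G x x
  arc-irrefl {x} e with arc-cases e
  ... | inj₁ old           = <-irrefl refl (topo x x old)
  ... | inj₂ (refl , x≡w) = v≢w x≡w

  Array Positions : Set
  Array     = ℕ → Maybe (Fin n)
  Positions = Fin n → ℕ

  Placed : Array → Positions → Fin n → Set
  Placed vt pos x = vt (pos x) ≡ just x

  -- Emptying slot k, which holds y: this is what every injection into a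
  -- queue does to the array.
  module Emptying (vt : Array) (pos : Positions) (k : ℕ) {y : Fin n}
                  (pos-of-slot : ∀ k x → vt k ≡ just x → pos x ≡ k) (vtk : vt k ≡ just y) where
    vt′ : Array
    vt′ = setVertex k nothing vt

    pos-y : pos y ≡ k
    pos-y = pos-of-slot k y vtk

    emptied : vt′ k ≡ nothing
    emptied = setVertex-here k nothing vt

    unchanged : ∀ {k′} → ¬ k′ ≡ k → vt′ k′ ≡ vt k′
    unchanged = setVertex-elsewhere k nothing vt _

    nonempty : ∀ {k′ x} → vt′ k′ ≡ just x → vt k′ ≡ just x
    nonempty {k′} e with k′ ≟ k
    ... | yes refl = ⊥-elim (just≢nothing (trans (sym e) emptied))
    ... | no k′≢k  = trans (sym (unchanged k′≢k)) e

    nonempty-≢y : ∀ {k′ x} → vt′ k′ ≡ just x → ¬ x ≡ y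
    nonempty-≢y {k′} e refl with k′ ≟ k
    ... | yes refl = just≢nothing (trans (sym e) emptied)
    ... | no k′≢k  = k′≢k (trans (sym (pos-of-slot k′ y (nonempty e))) pos-y)

    still-placed : ∀ {x} → Placed vt pos x → ¬ x ≡ y → Placed vt′ pos x
    still-placed {x} px x≢y = trans (unchanged px≢k) px
      where
      px≢k : ¬ pos x ≡ k
      px≢k e = x≢y (just-injective (trans (sym px) (trans (cong vt e) vtk)))

  record SearchInv (lo hi : ℕ) (F B : List (Fin n)) (vt : Array) : Set where
    field
      lo≤hi        : lo ≤ hi
      F-below      : ∀ {x} → x ∈ F → p x < lo
      B-above      : ∀ {x} → x ∈ B → hi ≤ p x
      untouched    : ∀ k → lo ≤ k → k < hi → vt k ≡ vx k
      from-initial : ∀ k x → vt k ≡ just x → vx k ≡ just x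
      unqueued     : ∀ k x → vt k ≡ just x → x ∉ F × x ∉ B
      in-place     : ∀ x → x ∉ F → x ∉ B → Placed vt p x
      F-closed     : ∀ {u} y → u ∈ F → Arc G u y → p y < lo → y ∈ F
      B-closed     : ∀ {z} y → z ∈ B → Arc G y z → hi ≤ p y → y ∈ B
      F-from-w     : ∀ {u} → u ∈ F → Star (Arc G) w u
      B-to-v       : ∀ {z} → z ∈ B → Star (Arc G) z v
      F-sorted     : AllPairs (λ x y → p x < p y) F
      B-sorted     : AllPairs (λ x y → p y < p x) B
      w∈F          : w ∈ F
      v∈B          : v ∈ B
      below        : ℕ
      below-eq     : 1 + below ≡ lo
      F-nulls      : nulls vt 1 below ≡ length F
      above        : ℕ
      above-eq     : hi + above ≡ suc n
      B-nulls      : nulls vt hi above ≡ length B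
  open SearchInv

  slot-pos : ∀ {lo hi F B vt} → SearchInv lo hi F B vt → ∀ k x → vt k ≡ just x → p x ≡ k
  slot-pos inv k x vtk = vx⇒p k x (from-initial inv k x vtk)

  slot : ∀ {lo hi F B vt} → SearchInv lo hi F B vt → ∀ k → lo ≤ k → k < hi → ∃[ y ] vt k ≡ just y
  slot {lo} {hi} inv k lo≤k k<hi with vx-full k 1≤k k≤n
    where
    1≤k : 1 ≤ k
    1≤k = ≤-trans (subst (1 ≤_) (below-eq inv) (s≤s z≤n)) lo≤k
    k≤n : k ≤ n
    k≤n = ≤-pred (≤-trans k<hi (subst (hi ≤_) (above-eq inv) (m≤m+n hi (above inv))))
  ... | y , vxk = y , trans (untouched inv k lo≤k k<hi) vxk

  skipI : ∀ {i j F B vt y} → SearchInv i j F B vt → i < j → vt i ≡ just y →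
          any (λ u → G u y) F ≡ false → SearchInv (suc i) j F B vt
  skipI {i} {j} {F} {B} {vt} {y} inv i<j vti noArc = record
    { lo≤hi = i<j
    ; F-below = λ x∈F → m<n⇒m<1+n (F-below inv x∈F)
    ; B-above = B-above inv
    ; untouched = λ k i<k k<j → untouched inv k (<⇒≤ i<k) k<j
    ; from-initial = from-initial inv ; unqueued = unqueued inv ; in-place = in-place inv
    ; F-closed = F-closed′
    ; B-closed = B-closed inv ; F-from-w = F-from-w inv ; B-to-v = B-to-v inv
    ; F-sorted = F-sorted inv ; B-sorted = B-sorted inv ; w∈F = w∈F inv ; v∈B = v∈B inv
    ; below = suc (below inv)
    ; below-eq = cong suc (below-eq inv)
    ; F-nulls = begin
        nulls vt 1 (suc (below inv))                   ≡⟨ nulls-snoc vt 1 (below inv) ⟩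
        nulls vt 1 (below inv) + null? (vt (1 + below inv)) ≡⟨ cong (λ k → nulls vt 1 (below inv) + null? (vt k)) (below-eq inv) ⟩
        nulls vt 1 (below inv) + null? (vt i)          ≡⟨ cong (λ z → nulls vt 1 (below inv) + null? z) vti ⟩
        nulls vt 1 (below inv) + 0                     ≡⟨ +-identityʳ _ ⟩
        nulls vt 1 (below inv)                         ≡⟨ F-nulls inv ⟩
        length F                                       ∎
    ; above = above inv ; above-eq = above-eq inv ; B-nulls = B-nulls inv
    }
    where
    open ≡-Reasoning
    -- y itself has no arc from F, so the closure extends to slot i
    F-closed′ : ∀ {u} y′ → u ∈ F → Arc G u y′ → p y′ < suc i → y′ ∈ F
    F-closed′ y′ u∈F u→y′ py′<1+i with m<1+n⇒m<n∨m≡n py′<1+i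
    ... | inj₁ py′<i = F-closed inv y′ u∈F u→y′ py′<i
    ... | inj₂ py′≡i with p-inj y′ y (trans py′≡i (sym (slot-pos inv i y vti)))
    ...   | refl = ⊥-elim (any-false (λ u → G u y) F noArc u∈F u→y′)

  injectF : ∀ {i j F B vt y} → SearchInv i j F B vt → i < j → vt i ≡ just y →
            any (λ u → G u y) F ≡ true → SearchInv (suc i) j (F ++ y ∷ []) B (setVertex i nothing vt)
  injectF {i} {j} {F} {B} {vt} {y} inv i<j vti arc = record
    { lo≤hi = i<j
    ; F-below = F-below′
    ; B-above = B-above inv
    ; untouched = λ k i<k k<j → trans (unchanged (>⇒≢ i<k)) (untouched inv k (<⇒≤ i<k) k<j)
    ; from-initial = λ k x e → from-initial inv k x (nonempty e)
    ; unqueued = λ k x e → [ proj₁ (unqueued inv k x (nonempty e)) , nonempty-≢y e ]′ ∘ ∈-snoc⁻ y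
                         , proj₂ (unqueued inv k x (nonempty e))
    ; in-place = λ x x∉F′ x∉B → still-placed (in-place inv x (x∉F′ ∘ ∈-++⁺ˡ) x∉B)
                                              (λ { refl → x∉F′ (∈-snoc-last F y) })
    ; F-closed = F-closed′
    ; B-closed = B-closed inv
    ; F-from-w = F-from-w′
    ; B-to-v = B-to-v inv
    ; F-sorted = allPairs-snoc y (F-sorted inv) (λ x∈F → subst (_ <_) (sym pos-y) (F-below inv x∈F))
    ; B-sorted = B-sorted inv ; w∈F = ∈-++⁺ˡ (w∈F inv) ; v∈B = v∈B inv
    ; below = suc (below inv)
    ; below-eq = cong suc (below-eq inv)
    ; F-nulls = begin
        nulls vt′ 1 (suc (below inv))                    ≡⟨ nulls-snoc vt′ 1 (below inv) ⟩
        nulls vt′ 1 (below inv) + null? (vt′ (1 + below inv))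
          ≡⟨ cong₂ _+_ (nulls-ext vt′ vt 1 (below inv) (λ k _ k<i → unchanged (<⇒≢ (subst (k <_) (below-eq inv) k<i))))
                       (cong (λ k → null? (vt′ k)) (below-eq inv)) ⟩
        nulls vt 1 (below inv) + null? (vt′ i)           ≡⟨ cong₂ _+_ (F-nulls inv) (cong null? emptied) ⟩
        length F + 1                                     ≡⟨ +-comm (length F) 1 ⟩
        suc (length F)                                   ≡⟨ sym (length-snoc F y) ⟩
        length (F ++ y ∷ [])                             ∎
    ; above = above inv ; above-eq = above-eq inv
    ; B-nulls = trans (nulls-ext vt′ vt j (above inv) (λ k j≤k _ → unchanged (>⇒≢ (<-≤-trans i<j j≤k)))) (B-nulls inv)
    }
    where
    open ≡-Reasoning
    open Emptying vt p i (slot-pos inv) vti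
    y≢v : ¬ y ≡ v
    y≢v refl = <-irrefl refl (<-≤-trans (subst (_< j) (sym pos-y) i<j) (B-above inv (v∈B inv)))
    F-below′ : ∀ {x} → x ∈ F ++ y ∷ [] → p x < suc i
    F-below′ x∈F′ with ∈-snoc⁻ y x∈F′
    ... | inj₁ x∈F  = m<n⇒m<1+n (F-below inv x∈F)
    ... | inj₂ refl = subst (_< suc i) (sym pos-y) (n<1+n i)
    -- arcs out of y go above slot i; other arcs are covered by the old closure or end in y
    F-closed′ : ∀ {u} y′ → u ∈ F ++ y ∷ [] → Arc G u y′ → p y′ < suc i → y′ ∈ F ++ y ∷ []
    F-closed′ y′ u∈F′ u→y′ py′<1+i with ∈-snoc⁻ y u∈F′
    ... | inj₂ refl = ⊥-elim (<-irrefl refl (≤-trans (subst (_< p y′) pos-y (p-mono-¬v u→y′ y≢v)) (≤-pred py′<1+i)))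
    ... | inj₁ u∈F with m<1+n⇒m<n∨m≡n py′<1+i
    ...   | inj₁ py′<i = ∈-++⁺ˡ (F-closed inv y′ u∈F u→y′ py′<i)
    ...   | inj₂ py′≡i with p-inj y′ y (trans py′≡i (sym pos-y))
    ...     | refl = ∈-snoc-last F y
    F-from-w′ : ∀ {u} → u ∈ F ++ y ∷ [] → Star (Arc G) w u
    F-from-w′ u∈F′ with ∈-snoc⁻ y u∈F′
    ... | inj₁ u∈F  = F-from-w inv u∈F
    ... | inj₂ refl with any-true (λ u → G u y) F arc
    ...   | u , u∈F , u→y = F-from-w inv u∈F ◅◅ (u→y ◅ ε)

  skipJ : ∀ {i j F B vt y} → SearchInv (suc i) (suc j) F B vt → i < j → vt j ≡ just y →
          any (λ z → G y z) B ≡ false → SearchInv (suc i) j F B vt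
  skipJ {i} {j} {F} {B} {vt} {y} inv i<j vtj noArc = record
    { lo≤hi = i<j
    ; F-below = F-below inv
    ; B-above = λ x∈B → <⇒≤ (B-above inv x∈B)
    ; untouched = λ k i<k k<j → untouched inv k i<k (m<n⇒m<1+n k<j)
    ; from-initial = from-initial inv ; unqueued = unqueued inv ; in-place = in-place inv
    ; F-closed = F-closed inv
    ; B-closed = B-closed′
    ; F-from-w = F-from-w inv ; B-to-v = B-to-v inv
    ; F-sorted = F-sorted inv ; B-sorted = B-sorted inv ; w∈F = w∈F inv ; v∈B = v∈B inv
    ; below = below inv ; below-eq = below-eq inv ; F-nulls = F-nulls inv
    ; above = suc (above inv)
    ; above-eq = trans (+-suc j (above inv)) (above-eq inv)
    ; B-nulls = trans (cong (λ z → null? z + nulls vt (suc j) (above inv)) vtj) (B-nulls inv)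
    }
    where
    -- y itself has no arc into B, so the closure extends to slot j
    B-closed′ : ∀ {z} y′ → z ∈ B → Arc G y′ z → j ≤ p y′ → y′ ∈ B
    B-closed′ y′ z∈B y′→z j≤py′ with m≤n⇒m<n∨m≡n j≤py′
    ... | inj₁ j<py′ = B-closed inv y′ z∈B y′→z j<py′
    ... | inj₂ j≡py′ with p-inj y′ y (trans (sym j≡py′) (sym (slot-pos inv j y vtj)))
    ...   | refl = ⊥-elim (any-false (λ z → G y z) B noArc z∈B y′→z)

  injectB : ∀ {i j F B vt y} → SearchInv (suc i) (suc j) F B vt → i < j → vt j ≡ just y →
            any (λ z → G y z) B ≡ true → SearchInv (suc i) j F (B ++ y ∷ []) (setVertex j nothing vt)
  injectB {i} {j} {F} {B} {vt} {y} inv i<j vtj arc = record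
    { lo≤hi = i<j
    ; F-below = F-below inv
    ; B-above = B-above′
    ; untouched = λ k i<k k<j → trans (unchanged (<⇒≢ k<j)) (untouched inv k i<k (m<n⇒m<1+n k<j))
    ; from-initial = λ k x e → from-initial inv k x (nonempty e)
    ; unqueued = λ k x e → proj₁ (unqueued inv k x (nonempty e))
                         , [ proj₂ (unqueued inv k x (nonempty e)) , nonempty-≢y e ]′ ∘ ∈-snoc⁻ y
    ; in-place = λ x x∉F x∉B′ → still-placed (in-place inv x x∉F (x∉B′ ∘ ∈-++⁺ˡ))
                                              (λ { refl → x∉B′ (∈-snoc-last B y) })
    ; F-closed = F-closed inv
    ; B-closed = B-closed′
    ; F-from-w = F-from-w inv
    ; B-to-v = B-to-v′
    ; F-sorted = F-sorted inv
    ; B-sorted = allPairs-snoc y (B-sorted inv) (λ x∈B → subst (_< _) (sym pos-y) (B-above inv x∈B))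
    ; w∈F = w∈F inv ; v∈B = ∈-++⁺ˡ (v∈B inv)
    ; below = below inv ; below-eq = below-eq inv
    ; F-nulls = trans (nulls-ext vt′ vt 1 (below inv)
                         (λ k _ k<1+i → unchanged (<⇒≢ (<-≤-trans (subst (k <_) (below-eq inv) k<1+i) i<j))))
                      (F-nulls inv)
    ; above = suc (above inv)
    ; above-eq = trans (+-suc j (above inv)) (above-eq inv)
    ; B-nulls = trans (cong₂ _+_ (cong null? emptied)
                                 (trans (nulls-ext vt′ vt (suc j) (above inv) (λ k j<k _ → unchanged (>⇒≢ j<k))) (B-nulls inv)))
                      (sym (length-snoc B y))
    }
    where
    open Emptying vt p j (slot-pos inv) vtj
    y≢w : ¬ y ≡ w
    y≢w refl = proj₁ (unqueued inv j y vtj) (w∈F inv)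
    B-above′ : ∀ {x} → x ∈ B ++ y ∷ [] → j ≤ p x
    B-above′ x∈B′ with ∈-snoc⁻ y x∈B′
    ... | inj₁ x∈B  = <⇒≤ (B-above inv x∈B)
    ... | inj₂ refl = ≤-reflexive (sym pos-y)
    -- arcs into y come from below slot j; other arcs are covered by the old closure or start at y
    B-closed′ : ∀ {z} y′ → z ∈ B ++ y ∷ [] → Arc G y′ z → j ≤ p y′ → y′ ∈ B ++ y ∷ []
    B-closed′ y′ z∈B′ y′→z j≤py′ with ∈-snoc⁻ y z∈B′
    ... | inj₂ refl = ⊥-elim (<-irrefl refl (<-≤-trans (subst (p y′ <_) pos-y (p-mono-¬w y′→z y≢w)) j≤py′))
    ... | inj₁ z∈B with m≤n⇒m<n∨m≡n j≤py′
    ...   | inj₁ j<py′ = ∈-++⁺ˡ (B-closed inv y′ z∈B y′→z j<py′)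
    ...   | inj₂ j≡py′ with p-inj y′ y (trans (sym j≡py′) (sym pos-y))
    ...     | refl = ∈-snoc-last B y
    B-to-v′ : ∀ {z} → z ∈ B ++ y ∷ [] → Star (Arc G) z v
    B-to-v′ z∈B′ with ∈-snoc⁻ y z∈B′
    ... | inj₁ z∈B  = B-to-v inv z∈B
    ... | inj₂ refl with any-true (λ z → G y z) B arc
    ...   | z , z∈B , y→z = y→z ◅ B-to-v inv z∈B

  vt₀ : Array
  vt₀ = setVertex pw nothing (setVertex pv nothing vx)

  vt₀-elsewhere : ∀ k → ¬ k ≡ pw → ¬ k ≡ pv → vt₀ k ≡ vx k
  vt₀-elsewhere k k≢pw k≢pv =
    trans (setVertex-elsewhere pw nothing (setVertex pv nothing vx) k k≢pw) (setVertex-elsewhere pv nothing vx k k≢pv)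

  vt₀-pw : vt₀ pw ≡ nothing
  vt₀-pw = setVertex-here pw nothing (setVertex pv nothing vx)

  vt₀-pv : vt₀ pv ≡ nothing
  vt₀-pv = trans (setVertex-elsewhere pw nothing (setVertex pv nothing vx) pv (λ pv≡pw → <-irrefl (sym pv≡pw) wv)) (setVertex-here pv nothing vx)

  vt₀-nonempty : ∀ {k x} → vt₀ k ≡ just x → vx k ≡ just x
  vt₀-nonempty {k} e with k ≟ pw | k ≟ pv
  ... | yes refl | _        = ⊥-elim (just≢nothing (trans (sym e) vt₀-pw))
  ... | no _     | yes refl = ⊥-elim (just≢nothing (trans (sym e) vt₀-pv))
  ... | no k≢pw  | no k≢pv  = trans (sym (vt₀-elsewhere k k≢pw k≢pv)) e

  initial-F-nulls : nulls vt₀ 1 pw ≡ 1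
  initial-F-nulls = begin
    nulls vt₀ 1 pw                      ≡⟨ cong (nulls vt₀ 1) (sym 1+d≡pw) ⟩
    nulls vt₀ 1 (suc d)                 ≡⟨ nulls-snoc vt₀ 1 d ⟩
    nulls vt₀ 1 d + null? (vt₀ (1 + d)) ≡⟨ cong₂ _+_ (nulls-full vt₀ 1 d filled) (cong (λ k → null? (vt₀ k)) 1+d≡pw) ⟩
    null? (vt₀ pw)                      ≡⟨ cong null? vt₀-pw ⟩
    1                                   ∎
    where
    open ≡-Reasoning
    d : ℕ
    d = pw ∸ 1
    1+d≡pw : 1 + d ≡ pw
    1+d≡pw = suc-∸1 (proj₁ (p-range w))
    filled : ∀ k → 1 ≤ k → k < 1 + d → ∃[ x ] vt₀ k ≡ just x
    filled k 1≤k k<1+d with vx-full k 1≤k (<⇒≤ (<-≤-trans (<-trans k<pw wv) (proj₂ (p-range v))))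
      where
      k<pw : k < pw
      k<pw = subst (k <_) 1+d≡pw k<1+d
    ... | x , vxk = x , trans (vt₀-elsewhere k (<⇒≢ k<pw) (<⇒≢ (<-trans k<pw wv))) vxk
      where
      k<pw : k < pw
      k<pw = subst (k <_) 1+d≡pw k<1+d

  initial-B-nulls : nulls vt₀ pv (suc (n ∸ pv)) ≡ 1
  initial-B-nulls = cong₂ _+_ (cong null? vt₀-pv) (nulls-full vt₀ (suc pv) (n ∸ pv) filled)
    where
    filled : ∀ k → suc pv ≤ k → k < suc pv + (n ∸ pv) → ∃[ x ] vt₀ k ≡ just x
    filled k pv<k k<1+n with vx-full k (≤-trans (s≤s z≤n) pv<k)
                                       (≤-pred (subst (k <_) (cong suc (m+[n∸m]≡n (proj₂ (p-range v)))) k<1+n))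
    ... | x , vxk = x , trans (vt₀-elsewhere k (>⇒≢ (<-trans wv pv<k)) (>⇒≢ pv<k)) vxk

  initialInv : SearchInv (suc pw) pv (w ∷ []) (v ∷ []) vt₀
  initialInv = record
    { lo≤hi = wv
    ; F-below = λ { (here refl) → n<1+n pw }
    ; B-above = λ { (here refl) → ≤-refl }
    ; untouched = λ k pw<k k<pv → vt₀-elsewhere k (>⇒≢ pw<k) (<⇒≢ k<pv)
    ; from-initial = λ k x e → vt₀-nonempty e
    ; unqueued = λ k x e → (λ { (here refl) → pw≢k (vx⇒p k w (vt₀-nonempty e)) e })
                         , (λ { (here refl) → pv≢k (vx⇒p k v (vt₀-nonempty e)) e })
    ; in-place = λ x x≢w x≢v → trans (vt₀-elsewhere (p x) (x≢w ∘ here ∘ p-inj x w) (x≢v ∘ here ∘ p-inj x v)) (p⇒vx x)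
    ; F-closed = λ { y (here refl) w→y py<1+pw →
                     ⊥-elim (<-irrefl refl (<-≤-trans (p-mono-¬v w→y (v≢w ∘ sym)) (≤-pred py<1+pw))) }
    ; B-closed = λ { y (here refl) y→v pv≤py → ⊥-elim (<-irrefl refl (<-≤-trans (p-mono-¬w y→v v≢w) pv≤py)) }
    ; F-from-w = λ { (here refl) → ε }
    ; B-to-v = λ { (here refl) → ε }
    ; F-sorted = All.[] ∷ []
    ; B-sorted = All.[] ∷ []
    ; w∈F = here refl
    ; v∈B = here refl
    ; below = pw
    ; below-eq = refl
    ; F-nulls = initial-F-nulls
    ; above = suc (n ∸ pv)
    ; above-eq = trans (+-suc pv (n ∸ pv)) (cong suc (m+[n∸m]≡n (proj₂ (p-range v))))
    ; B-nulls = initial-B-nulls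
    }
    where
    pw≢k : ∀ {k x} → p w ≡ k → vt₀ k ≡ just x → ⊥
    pw≢k refl e = just≢nothing (trans (sym e) vt₀-pw)
    pv≢k : ∀ {k x} → p v ≡ k → vt₀ k ≡ just x → ⊥
    pv≢k refl e = just≢nothing (trans (sym e) vt₀-pv)

  -- The outcome of a search run: a state with i = j = meet in which the
  -- invariant holds, reached either at the end of an i-scan (queues of
  -- equal length) or at the end of a j-scan (F one longer, and slot meet
  -- already emptied by the last injection into F).
  record Stopped (s : St n) : Set where
    constructor stopped
    field
      qF qB : List (Fin n)
      meet  : ℕ
      vt    : Array
      state : s ≡ st qF qB meet meet vt p
      inv   : (SearchInv meet meet qF qB vt × length qF ≡ length qB)
            ⊎ (SearchInv (suc meet) (suc meet) qF qB vt × length qF ≡ suc (length qB) × vt meet ≡ nothing)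

  Stops : (ℕ → Maybe (St n)) → Set
  Stops run = ∃[ f ] ∃[ s ] (run f ≡ just s × Stopped s)

  mutual
    runWhileI : ∀ d F B i j vt → i + d ≡ j → SearchInv i j F B vt → length F ≡ length B →
                Stops (λ f → whileI f (st F B i j vt p))
    runWhileI zero F B i j vt i+0≡j inv len with trans (sym (+-identityʳ i)) i+0≡j
    ... | refl = 2 , _ , whileI-met F B i vt p , stopped F B i vt refl (inj₁ (inv , len))
    runWhileI (suc d) F B i j vt i+d≡j inv len =
      scanI d F B i j vt i+d≡j inv len (subst (i <_) i+d≡j (m<m+n i z<s))

    scanI : ∀ d F B i j vt → i + suc d ≡ j → SearchInv i j F B vt → length F ≡ length B → i < j →
            Stops (λ f → whileI f (st F B i j vt p))
    scanI d F B i j vt i+d≡j inv len i<j with slot inv i ≤-refl i<j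
    ... | y , vti with any (λ u → G u y) F in arc
    ... | false with runWhileI d F B (suc i) j vt (trans (sym (+-suc i d)) i+d≡j) (skipI inv i<j vti arc) len
    ...   | f , s , run , fin = suc f , s , trans (whileI-skip f F B i j vt p y i<j vti arc) run , fin
    scanI d F B i j vt i+d≡j inv len i<j | y , vti | true
      with runWhileJ d (F ++ y ∷ []) B i (j ∸ 1) (setVertex i nothing vt)
             (cong (_∸ 1) (trans (sym (+-suc i d)) i+d≡j))
             (subst (λ hi → SearchInv (suc i) hi (F ++ y ∷ []) B (setVertex i nothing vt)) (sym (suc-∸1 i<j))
                    (injectF inv i<j vti arc))
             (trans (length-snoc F y) (cong suc len))
             (setVertex-here i nothing vt)
    ... | f , s , run , fin = suc (suc f) , s , trans (whileI-inject f F B i j vt p y i<j vti arc) run , fin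

    runWhileJ : ∀ d F B i j vt → i + d ≡ j → SearchInv (suc i) (suc j) F B vt → length F ≡ suc (length B) →
                vt i ≡ nothing → Stops (λ f → whileJ f (st F B i j vt p))
    runWhileJ zero F B i j vt i+0≡j inv len vti with trans (sym (+-identityʳ i)) i+0≡j
    ... | refl = 2 , _ , whileJ-met F B i vt p , stopped F B i vt refl (inj₂ (inv , len , vti))
    runWhileJ (suc d) F B i j vt i+d≡j inv len vti =
      scanJ d F B i j vt i+d≡j inv len vti (subst (i <_) i+d≡j (m<m+n i z<s))

    scanJ : ∀ d F B i j vt → i + suc d ≡ j → SearchInv (suc i) (suc j) F B vt → length F ≡ suc (length B) →
            vt i ≡ nothing → i < j → Stops (λ f → whileJ f (st F B i j vt p))
    scanJ d F B i j vt i+d≡j inv len vti i<j with slot inv j i<j (n<1+n j)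
    ... | y , vtj with any (λ z → G y z) B in arc
    ... | false
      with runWhileJ d F B i (j ∸ 1) vt (cong (_∸ 1) (trans (sym (+-suc i d)) i+d≡j))
             (subst (λ hi → SearchInv (suc i) hi F B vt) (sym (suc-∸1 i<j)) (skipJ inv i<j vtj arc)) len vti
    ...   | f , s , run , fin = suc f , s , trans (whileJ-skip f F B i j vt p y i<j vtj arc) run , fin
    scanJ d F B i j vt i+d≡j inv len vti i<j | y , vtj | true
      with runWhileI d F (B ++ y ∷ []) (suc i) j (setVertex j nothing vt) (trans (sym (+-suc i d)) i+d≡j)
             (injectB inv i<j vtj arc) (trans len (sym (length-snoc B y)))
    ... | f , s , run , fin = suc (suc (suc f)) , s , trans (whileJ-inject f F B i j vt p y i<j vtj arc) run , fin

  searchStops : ∃[ f ] ∃[ s ] (search f v w p vx ≡ just s × Stopped s)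
  searchStops with runWhileI (pv ∸ suc pw) (w ∷ []) (v ∷ []) (suc pw) pv vt₀ (m+[n∸m]≡n wv) initialInv refl
  ... | f , s , run , fin = suc f , s , run , fin

  NumberedTopologically : St n → Set
  NumberedTopologically s = IsNumbering n (position s) (vertex s) × Topological G (position s)

  module Reordering (m : ℕ) where

    -- Why the F-loop, now at slot i, will put x before y.  Slots below m
    -- are later filled by the B-loop from m downwards, slots from i upwards
    -- by the F-loop, and both queues are placed in queue order.
    data PlacedBeforeF (F B : List (Fin n)) (i : ℕ) (vt : Array) (pos : Positions) (x y : Fin n) : Set where
      arr-arr  : Placed vt pos x → Placed vt pos y → pos x < pos y → PlacedBeforeF F B i vt pos x y
      arr-B    : Placed vt pos x → pos x < m → y ∈ B → PlacedBeforeF F B i vt pos x y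
      B-arr    : x ∈ B → Placed vt pos y → m ≤ pos y → PlacedBeforeF F B i vt pos x y
      arr-F    : Placed vt pos x → pos x < i → y ∈ F → PlacedBeforeF F B i vt pos x y
      F-arr    : x ∈ F → Placed vt pos y → i ≤ pos y → PlacedBeforeF F B i vt pos x y
      B-F      : x ∈ B → y ∈ F → PlacedBeforeF F B i vt pos x y
      within-B : Precedes B y x → PlacedBeforeF F B i vt pos x y
      within-F : Precedes F x y → PlacedBeforeF F B i vt pos x y

    -- The same for the B-loop, now below slot j.
    data PlacedBeforeB (B : List (Fin n)) (j : ℕ) (vt : Array) (pos : Positions) (x y : Fin n) : Set where
      arr-arr  : Placed vt pos x → Placed vt pos y → pos x < pos y → PlacedBeforeB B j vt pos x y
      arr-B    : Placed vt pos x → pos x < j → y ∈ B → PlacedBeforeB B j vt pos x y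
      B-arr    : x ∈ B → Placed vt pos y → j ≤ pos y → PlacedBeforeB B j vt pos x y
      within-B : Precedes B y x → PlacedBeforeB B j vt pos x y

    record ReorderInvF (d : ℕ) (F B : List (Fin n)) (i : ℕ) (vt : Array) (pos : Positions) : Set where
      field
        m≤i              : m ≤ i
        1≤m              : 1 ≤ m
        i+dF≡1+n         : i + d ≡ suc n
        F-gaps           : nulls vt i d ≡ length F    -- room for F above i
        dB               : ℕ
        1+dB≡m           : 1 + dB ≡ m
        B-gaps           : nulls vt 1 dB ≡ length B   -- room for B below m
        filled           : ∀ k → m ≤ k → k < i → ∃[ x ] vt k ≡ just x
        pos-of-slot      : ∀ k x → vt k ≡ just x → pos x ≡ k
        slot-unqueued    : ∀ k x → vt k ≡ just x → x ∉ F × x ∉ B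
        slot-range       : ∀ k x → vt k ≡ just x → 1 ≤ k × k ≤ n
        placed-or-queued : ∀ x → Placed vt pos x ⊎ x ∈ F ⊎ x ∈ B
        F-unique         : Unique F
        B-unique         : Unique B
        FB-disjoint      : ∀ {x} → x ∈ F → x ∈ B → ⊥
        order            : ∀ x y → Arc G x y → PlacedBeforeF F B i vt pos x y
    open ReorderInvF

    record ReorderInvB (d : ℕ) (B : List (Fin n)) (j : ℕ) (vt : Array) (pos : Positions) : Set where
      field
        1+d≡j            : 1 + d ≡ j
        j≤1+n            : j ≤ suc n
        B-gaps           : nulls vt 1 d ≡ length B
        filled           : ∀ k → j ≤ k → k ≤ n → ∃[ x ] vt k ≡ just x
        pos-of-slot      : ∀ k x → vt k ≡ just x → pos x ≡ k
        slot-unqueued    : ∀ k x → vt k ≡ just x → x ∉ B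
        slot-range       : ∀ k x → vt k ≡ just x → 1 ≤ k × k ≤ n
        placed-or-queued : ∀ x → Placed vt pos x ⊎ x ∈ B
        B-unique         : Unique B
        order            : ∀ x y → Arc G x y → PlacedBeforeB B j vt pos x y
    open ReorderInvB

    module Filling (vt : Array) (pos : Positions) (k : ℕ) (f : Fin n) (vtk : vt k ≡ nothing) where
      vt′ : Array
      vt′ = setVertex k (just f) vt

      pos′ : Positions
      pos′ = setPosition f k pos

      pos′-f : pos′ f ≡ k
      pos′-f = setPosition-here f k pos

      placed-f : Placed vt′ pos′ f
      placed-f = trans (cong vt′ pos′-f) (setVertex-here k (just f) vt)

      unchanged : ∀ {k′} → ¬ k′ ≡ k → vt′ k′ ≡ vt k′
      unchanged = setVertex-elsewhere k (just f) vt _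

      slot-cases : ∀ {k′ x} → vt′ k′ ≡ just x → (k′ ≡ k × x ≡ f) ⊎ (¬ k′ ≡ k × vt k′ ≡ just x)
      slot-cases {k′} e with k′ ≟ k
      ... | yes refl = inj₁ (refl , just-injective (trans (sym e) (setVertex-here k (just f) vt)))
      ... | no k′≢k  = inj₂ (k′≢k , trans (sym (unchanged k′≢k)) e)

      placed-≢k : ∀ {x} → Placed vt pos x → ¬ pos x ≡ k
      placed-≢k px e = just≢nothing (trans (sym px) (trans (cong vt e) vtk))

      same-pos : ∀ {x} → ¬ x ≡ f → pos′ x ≡ pos x
      same-pos = setPosition-elsewhere f k pos _

      still-placed : ∀ {x} → Placed vt pos x → ¬ x ≡ f → Placed vt′ pos′ x
      still-placed {x} px x≢f = trans (cong vt′ (same-pos x≢f)) (trans (unchanged (placed-≢k px)) px)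

    B-gaps-kept : ∀ {d F B i vt pos} (inv : ReorderInvF d F B i vt pos) (vt′ : Array) →
                  (∀ {k} → ¬ k ≡ i → vt′ k ≡ vt k) → nulls vt′ 1 (dB inv) ≡ length B
    B-gaps-kept {i = i} {vt} inv vt′ unchanged =
      trans (nulls-ext vt′ vt 1 (dB inv) (λ k _ k<1+dB → unchanged (k≢i k k<1+dB))) (B-gaps inv)
      where
      k≢i : ∀ k → k < 1 + dB inv → ¬ k ≡ i
      k≢i k k<1+dB k≡i = <-irrefl k≡i (<-≤-trans (subst (k <_) (1+dB≡m inv) k<1+dB) (m≤i inv))

    module PopF {d f q B i vt pos} (inv : ReorderInvF (suc d) (f ∷ q) B i vt pos) (vti : vt i ≡ nothing) where
      open Filling vt pos i f vti public
      slot-≢f : ∀ {k x} → vt k ≡ just x → ¬ x ≡ f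
      slot-≢f {k} e refl = proj₁ (slot-unqueued inv k f e) (here refl)
      moved : ∀ {x} → Placed vt pos x → Placed vt′ pos′ x
      moved px = still-placed px (slot-≢f px)
      keeps : ∀ {x} → Placed vt pos x → pos′ x ≡ pos x
      keeps px = same-pos (slot-≢f px)
      -- f now occupies slot i, so reasons mentioning it become array reasons
      transport : ∀ {x y} → PlacedBeforeF (f ∷ q) B i vt pos x y → PlacedBeforeF q B (suc i) vt′ pos′ x y
      transport (arr-arr px py l)        = arr-arr (moved px) (moved py) (subst₂ _<_ (sym (keeps px)) (sym (keeps py)) l)
      transport (arr-B px l y∈B)         = arr-B (moved px) (subst (_< m) (sym (keeps px)) l) y∈B
      transport (B-arr x∈B py l)         = B-arr x∈B (moved py) (subst (m ≤_) (sym (keeps py)) l)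
      transport (arr-F px l (here refl)) = arr-arr (moved px) placed-f (subst₂ _<_ (sym (keeps px)) (sym pos′-f) l)
      transport (arr-F px l (there y∈q)) = arr-F (moved px) (subst (_< suc i) (sym (keeps px)) (m<n⇒m<1+n l)) y∈q
      transport (F-arr (here refl) py l) =
        arr-arr placed-f (moved py) (subst₂ _<_ (sym pos′-f) (sym (keeps py)) (≤∧≢⇒< l (λ e → placed-≢k py (sym e))))
      transport (F-arr (there x∈q) py l) =
        F-arr x∈q (moved py) (subst (suc i ≤_) (sym (keeps py)) (≤∧≢⇒< l (λ e → placed-≢k py (sym e))))
      transport (B-F x∈B (here refl))    = B-arr x∈B placed-f (subst (m ≤_) (sym pos′-f) (m≤i inv))
      transport (B-F x∈B (there y∈q))    = B-F x∈B y∈q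
      transport (within-B y≺x)           = within-B y≺x
      transport {x} (within-F x≺y) with x ≟V f
      ... | yes refl = arr-F placed-f (subst (_< suc i) (sym pos′-f) (n<1+n i)) (Precedes-head-tail (F-unique inv) x≺y)
      ... | no x≢f   = within-F (Precedes-tail x≺y x≢f)

    invF-pop : ∀ {d f q B i vt pos} → ReorderInvF (suc d) (f ∷ q) B i vt pos → vt i ≡ nothing →
               ReorderInvF d q B (suc i) (setVertex i (just f) vt) (setPosition f i pos)
    invF-pop {d} {f} {q} {B} {i} {vt} {pos} inv vti = record
      { m≤i              = ≤-trans (m≤i inv) (n≤1+n i)
      ; 1≤m              = 1≤m inv
      ; i+dF≡1+n         = trans (sym (+-suc i d)) (i+dF≡1+n inv)
      ; F-gaps           = trans (nulls-ext vt′ vt (suc i) d (λ k i<k _ → unchanged (>⇒≢ i<k)))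
                                 (suc-injective (trans (cong (λ z → null? z + nulls vt (suc i) d) (sym vti)) (F-gaps inv)))
      ; dB               = dB inv
      ; 1+dB≡m           = 1+dB≡m inv
      ; B-gaps           = B-gaps-kept inv vt′ unchanged
      ; filled           = filled′
      ; pos-of-slot      = pos-of-slot′
      ; slot-unqueued    = slot-unqueued′
      ; slot-range       = slot-range′
      ; placed-or-queued = placed-or-queued′
      ; F-unique         = AllPairs.tail (F-unique inv)
      ; B-unique         = B-unique inv
      ; FB-disjoint      = λ x∈q x∈B → FB-disjoint inv (there x∈q) x∈B
      ; order            = λ x y x→y → transport (order inv x y x→y)
      }
      where
      open PopF inv vti
      filled′ : ∀ k → m ≤ k → k < suc i → ∃[ x ] vt′ k ≡ just x
      filled′ k m≤k k<1+i with k ≟ i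
      ... | yes refl = f , setVertex-here i (just f) vt
      ... | no k≢i   with filled inv k m≤k (≤∧≢⇒< (≤-pred k<1+i) k≢i)
      ...   | x , vtk = x , trans (unchanged k≢i) vtk
      pos-of-slot′ : ∀ k x → vt′ k ≡ just x → pos′ x ≡ k
      pos-of-slot′ k x e with slot-cases e
      ... | inj₁ (refl , refl)  = pos′-f
      ... | inj₂ (_ , vtk)      = trans (same-pos (slot-≢f vtk)) (pos-of-slot inv k x vtk)
      slot-unqueued′ : ∀ k x → vt′ k ≡ just x → x ∉ q × x ∉ B
      slot-unqueued′ k x e with slot-cases e
      ... | inj₁ (refl , refl) = Unique-head (F-unique inv) , FB-disjoint inv (here refl)
      ... | inj₂ (_ , vtk)     = (λ x∈q → proj₁ (slot-unqueued inv k x vtk) (there x∈q)) , proj₂ (slot-unqueued inv k x vtk)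
      slot-range′ : ∀ k x → vt′ k ≡ just x → 1 ≤ k × k ≤ n
      slot-range′ k x e with slot-cases e
      ... | inj₁ (refl , refl) = ≤-trans (1≤m inv) (m≤i inv) , ≤-pred (subst (i <_) (i+dF≡1+n inv) (m<m+n i z<s))
      ... | inj₂ (_ , vtk)     = slot-range inv k x vtk
      placed-or-queued′ : ∀ x → Placed vt′ pos′ x ⊎ x ∈ q ⊎ x ∈ B
      placed-or-queued′ x with x ≟V f | placed-or-queued inv x
      ... | yes refl | _                     = inj₁ placed-f
      ... | no _     | inj₁ px               = inj₁ (moved px)
      ... | no x≢f   | inj₂ (inj₁ (here e))  = ⊥-elim (x≢f e)
      ... | no _     | inj₂ (inj₁ (there x∈q)) = inj₂ (inj₁ x∈q)
      ... | no _     | inj₂ (inj₂ x∈B)       = inj₂ (inj₂ x∈B)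

    module InjectF {d F B i vt pos y} (inv : ReorderInvF (suc d) F B i vt pos) (vti : vt i ≡ just y) where
      open Emptying vt pos i (pos-of-slot inv) vti public
      y∉F : y ∉ F
      y∉F = proj₁ (slot-unqueued inv i y vti)
      y∈F′ : y ∈ F ++ y ∷ []
      y∈F′ = ∈-snoc-last F y
      -- y now sits at the end of F, at or above slot i
      transport : ∀ {x z} → PlacedBeforeF F B i vt pos x z → PlacedBeforeF (F ++ y ∷ []) B i vt′ pos x z
      transport {x} {z} (arr-arr px pz l) with x ≟V y | z ≟V y
      ... | yes refl | yes refl = ⊥-elim (<-irrefl refl l)
      ... | yes refl | no z≢y   = F-arr y∈F′ (still-placed pz z≢y) (<⇒≤ (subst (_< pos z) pos-y l))
      ... | no x≢y   | yes refl = arr-F (still-placed px x≢y) (subst (pos x <_) pos-y l) y∈F′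
      ... | no x≢y   | no z≢y   = arr-arr (still-placed px x≢y) (still-placed pz z≢y) l
      transport {x} (arr-B px l z∈B) = arr-B (still-placed px x≢y) l z∈B
        where
        x≢y : ¬ x ≡ y
        x≢y refl = <-irrefl pos-y (<-≤-trans l (m≤i inv))
      transport {z = z} (B-arr x∈B pz l) with z ≟V y
      ... | yes refl = B-F x∈B y∈F′
      ... | no z≢y   = B-arr x∈B (still-placed pz z≢y) l
      transport {x} (arr-F px l z∈F) = arr-F (still-placed px x≢y) l (∈-++⁺ˡ z∈F)
        where
        x≢y : ¬ x ≡ y
        x≢y refl = <-irrefl pos-y l
      transport {z = z} (F-arr x∈F pz l) with z ≟V y
      ... | yes refl = within-F (Precedes-last y x∈F)
      ... | no z≢y   = F-arr (∈-++⁺ˡ x∈F) (still-placed pz z≢y) l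
      transport (B-F x∈B z∈F)  = B-F x∈B (∈-++⁺ˡ z∈F)
      transport (within-B z≺x) = within-B z≺x
      transport (within-F x≺z) = within-F (Precedes-snoc y x≺z)

    invF-inject : ∀ {d F B i vt pos y} → ReorderInvF (suc d) F B i vt pos → vt i ≡ just y →
                  ReorderInvF (suc d) (F ++ y ∷ []) B i (setVertex i nothing vt) pos
    invF-inject {d} {F} {B} {i} {vt} {pos} {y} inv vti = record
      { m≤i              = m≤i inv
      ; 1≤m              = 1≤m inv
      ; i+dF≡1+n         = i+dF≡1+n inv
      ; F-gaps           = F-gaps′
      ; dB               = dB inv
      ; 1+dB≡m           = 1+dB≡m inv
      ; B-gaps           = B-gaps-kept inv vt′ unchanged
      ; filled           = filled′
      ; pos-of-slot      = λ k x e → pos-of-slot inv k x (nonempty e)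
      ; slot-unqueued    = slot-unqueued′
      ; slot-range       = λ k x e → slot-range inv k x (nonempty e)
      ; placed-or-queued = placed-or-queued′
      ; F-unique         = allPairs-snoc y (F-unique inv) (λ x∈F x≡y → y∉F (subst (_∈ F) x≡y x∈F))
      ; B-unique         = B-unique inv
      ; FB-disjoint      = FB-disjoint′
      ; order            = λ x z x→z → transport (order inv x z x→z)
      }
      where
      open InjectF inv vti
      F-gaps′ : nulls vt′ i (suc d) ≡ length (F ++ y ∷ [])
      F-gaps′ = begin
        null? (vt′ i) + nulls vt′ (suc i) d ≡⟨ cong (λ z → null? z + nulls vt′ (suc i) d) (setVertex-here i nothing vt) ⟩
        suc (nulls vt′ (suc i) d)           ≡⟨ cong suc (nulls-ext vt′ vt (suc i) d (λ k i<k _ → unchanged (>⇒≢ i<k))) ⟩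
        suc (nulls vt (suc i) d)            ≡⟨ cong suc (trans (cong (λ z → null? z + nulls vt (suc i) d) (sym vti)) (F-gaps inv)) ⟩
        suc (length F)                      ≡⟨ sym (length-snoc F y) ⟩
        length (F ++ y ∷ [])                ∎
        where open ≡-Reasoning
      filled′ : ∀ k → m ≤ k → k < i → ∃[ x ] vt′ k ≡ just x
      filled′ k m≤k k<i with filled inv k m≤k k<i
      ... | x , vtk = x , trans (unchanged (<⇒≢ k<i)) vtk
      slot-unqueued′ : ∀ k x → vt′ k ≡ just x → x ∉ F ++ y ∷ [] × x ∉ B
      slot-unqueued′ k x e = [ proj₁ (slot-unqueued inv k x (nonempty e)) , nonempty-≢y e ]′ ∘ ∈-snoc⁻ y
                           , proj₂ (slot-unqueued inv k x (nonempty e))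
      placed-or-queued′ : ∀ x → Placed vt′ pos x ⊎ x ∈ F ++ y ∷ [] ⊎ x ∈ B
      placed-or-queued′ x with x ≟V y | placed-or-queued inv x
      ... | yes refl | _               = inj₂ (inj₁ y∈F′)
      ... | no x≢y   | inj₁ px         = inj₁ (still-placed px x≢y)
      ... | no _     | inj₂ (inj₁ x∈F) = inj₂ (inj₁ (∈-++⁺ˡ x∈F))
      ... | no _     | inj₂ (inj₂ x∈B) = inj₂ (inj₂ x∈B)
      FB-disjoint′ : ∀ {x} → x ∈ F ++ y ∷ [] → x ∈ B → ⊥
      FB-disjoint′ x∈F′ x∈B with ∈-snoc⁻ y x∈F′
      ... | inj₁ x∈F  = FB-disjoint inv x∈F x∈B
      ... | inj₂ refl = proj₂ (slot-unqueued inv i y vti) x∈B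

    invF-skip : ∀ {d F B i vt pos y} → ReorderInvF (suc d) F B i vt pos → vt i ≡ just y →
                any (λ u → G u y) F ≡ false → ReorderInvF d F B (suc i) vt pos
    invF-skip {d} {F} {B} {i} {vt} {pos} {y} inv vti noArc = record
      { m≤i              = ≤-trans (m≤i inv) (n≤1+n i)
      ; 1≤m              = 1≤m inv
      ; i+dF≡1+n         = trans (sym (+-suc i d)) (i+dF≡1+n inv)
      ; F-gaps           = trans (cong (λ z → null? z + nulls vt (suc i) d) (sym vti)) (F-gaps inv)
      ; dB               = dB inv
      ; 1+dB≡m           = 1+dB≡m inv
      ; B-gaps           = B-gaps inv
      ; filled           = filled′
      ; pos-of-slot      = pos-of-slot inv
      ; slot-unqueued    = slot-unqueued inv
      ; slot-range       = slot-range inv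
      ; placed-or-queued = placed-or-queued inv
      ; F-unique         = F-unique inv
      ; B-unique         = B-unique inv
      ; FB-disjoint      = FB-disjoint inv
      ; order            = λ x z x→z → transport x→z (order inv x z x→z)
      }
      where
      filled′ : ∀ k → m ≤ k → k < suc i → ∃[ x ] vt k ≡ just x
      filled′ k m≤k k<1+i with k ≟ i
      ... | yes refl = y , vti
      ... | no k≢i   = filled inv k m≤k (≤∧≢⇒< (≤-pred k<1+i) k≢i)
      -- only an arc from F into y could be affected, and there is none
      transport : ∀ {x z} → Arc G x z → PlacedBeforeF F B i vt pos x z → PlacedBeforeF F B (suc i) vt pos x z
      transport _ (arr-arr px pz l)  = arr-arr px pz l
      transport _ (arr-B px l z∈B)   = arr-B px l z∈B
      transport _ (B-arr x∈B pz l)   = B-arr x∈B pz l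
      transport _ (arr-F px l z∈F)   = arr-F px (m<n⇒m<1+n l) z∈F
      transport {z = z} x→z (F-arr x∈F pz l) with pos z ≟ i
      ... | yes pz≡i with just-injective (trans (sym pz) (trans (cong vt pz≡i) vti))
      ...   | refl = ⊥-elim (any-false (λ u → G u y) F noArc x∈F x→z)
      transport _ (F-arr x∈F pz l) | no pz≢i = F-arr x∈F pz (≤∧≢⇒< l (λ e → pz≢i (sym e)))
      transport _ (B-F x∈B z∈F)    = B-F x∈B z∈F
      transport _ (within-B z≺x)   = within-B z≺x
      transport _ (within-F x≺z)   = within-F x≺z

    -- Popping the head b of B into the empty slot j - 1 = suc d.
    module PopB {d b q vt pos} (inv : ReorderInvB (suc d) (b ∷ q) (suc (suc d)) vt pos) (vtJ : vt (suc d) ≡ nothing) where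
      open Filling vt pos (suc d) b vtJ public
      slot-≢b : ∀ {k x} → vt k ≡ just x → ¬ x ≡ b
      slot-≢b {k} e refl = slot-unqueued inv k b e (here refl)
      moved : ∀ {x} → Placed vt pos x → Placed vt′ pos′ x
      moved px = still-placed px (slot-≢b px)
      keeps : ∀ {x} → Placed vt pos x → pos′ x ≡ pos x
      keeps px = same-pos (slot-≢b px)
      below-J : ∀ {x} → Placed vt pos x → pos x < suc (suc d) → pos x < suc d
      below-J px l = ≤∧≢⇒< (≤-pred l) (placed-≢k px)
      -- b now occupies slot j - 1
      transport : ∀ {x y} → PlacedBeforeB (b ∷ q) (suc (suc d)) vt pos x y → PlacedBeforeB q (suc d) vt′ pos′ x y
      transport (arr-arr px py l)        = arr-arr (moved px) (moved py) (subst₂ _<_ (sym (keeps px)) (sym (keeps py)) l)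
      transport (arr-B px l (here refl)) = arr-arr (moved px) placed-f (subst₂ _<_ (sym (keeps px)) (sym pos′-f) (below-J px l))
      transport (arr-B px l (there y∈q)) = arr-B (moved px) (subst (_< suc d) (sym (keeps px)) (below-J px l)) y∈q
      transport (B-arr (here refl) py l) = arr-arr placed-f (moved py) (subst₂ _<_ (sym pos′-f) (sym (keeps py)) l)
      transport (B-arr (there x∈q) py l) = B-arr x∈q (moved py) (subst (suc d ≤_) (sym (keeps py)) (<⇒≤ l))
      transport {y = y} (within-B y≺x) with y ≟V b
      ... | yes refl = B-arr (Precedes-head-tail (B-unique inv) y≺x) placed-f (≤-reflexive (sym pos′-f))
      ... | no y≢b   = within-B (Precedes-tail y≺x y≢b)

    invB-pop : ∀ {d b q j vt pos} → ReorderInvB (suc d) (b ∷ q) j vt pos → vt (j ∸ 1) ≡ nothing →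
               ReorderInvB d q (j ∸ 1) (setVertex (j ∸ 1) (just b) vt) (setPosition b (j ∸ 1) pos)
    invB-pop {d} {b} {q} {j} {vt} {pos} inv vtJ with 1+d≡j inv
    ... | refl = record
      { 1+d≡j            = refl
      ; j≤1+n            = ≤-trans (n≤1+n (suc d)) (j≤1+n inv)
      ; B-gaps           = trans (nulls-ext vt′ vt 1 d (λ k _ k<1+d → unchanged (<⇒≢ k<1+d))) B-gaps′
      ; filled           = filled′
      ; pos-of-slot      = pos-of-slot′
      ; slot-unqueued    = slot-unqueued′
      ; slot-range       = slot-range′
      ; placed-or-queued = placed-or-queued′
      ; B-unique         = AllPairs.tail (B-unique inv)
      ; order            = λ x y x→y → transport (order inv x y x→y)
      }
      where
      open PopB inv vtJ
      B-gaps′ : nulls vt 1 d ≡ length q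
      B-gaps′ = suc-injective (begin
        suc (nulls vt 1 d)                ≡⟨ +-comm 1 (nulls vt 1 d) ⟩
        nulls vt 1 d + 1                  ≡⟨ cong (λ z → nulls vt 1 d + null? z) (sym vtJ) ⟩
        nulls vt 1 d + null? (vt (suc d)) ≡⟨ sym (nulls-snoc vt 1 d) ⟩
        nulls vt 1 (suc d)                ≡⟨ B-gaps inv ⟩
        suc (length q)                    ∎)
        where open ≡-Reasoning
      filled′ : ∀ k → suc d ≤ k → k ≤ n → ∃[ x ] vt′ k ≡ just x
      filled′ k J≤k k≤n with k ≟ suc d
      ... | yes refl = b , setVertex-here (suc d) (just b) vt
      ... | no k≢J   with filled inv k (≤∧≢⇒< J≤k (λ e → k≢J (sym e))) k≤n
      ...   | x , vtk = x , trans (unchanged k≢J) vtk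
      pos-of-slot′ : ∀ k x → vt′ k ≡ just x → pos′ x ≡ k
      pos-of-slot′ k x e with slot-cases e
      ... | inj₁ (refl , refl) = pos′-f
      ... | inj₂ (_ , vtk)     = trans (same-pos (slot-≢b vtk)) (pos-of-slot inv k x vtk)
      slot-unqueued′ : ∀ k x → vt′ k ≡ just x → x ∉ q
      slot-unqueued′ k x e with slot-cases e
      ... | inj₁ (refl , refl) = Unique-head (B-unique inv)
      ... | inj₂ (_ , vtk)     = λ x∈q → slot-unqueued inv k x vtk (there x∈q)
      slot-range′ : ∀ k x → vt′ k ≡ just x → 1 ≤ k × k ≤ n
      slot-range′ k x e with slot-cases e
      ... | inj₁ (refl , refl) = s≤s z≤n , ≤-pred (j≤1+n inv)
      ... | inj₂ (_ , vtk)     = slot-range inv k x vtk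
      placed-or-queued′ : ∀ x → Placed vt′ pos′ x ⊎ x ∈ q
      placed-or-queued′ x with x ≟V b | placed-or-queued inv x
      ... | yes refl | _                = inj₁ placed-f
      ... | no _     | inj₁ px          = inj₁ (moved px)
      ... | no x≢b   | inj₂ (here e)    = ⊥-elim (x≢b e)
      ... | no _     | inj₂ (there x∈q) = inj₂ x∈q

    -- Injecting the vertex y of slot j - 1 = suc d into B.
    module InjectB {d B vt pos y} (inv : ReorderInvB (suc d) B (suc (suc d)) vt pos) (vtJ : vt (suc d) ≡ just y) where
      open Emptying vt pos (suc d) (pos-of-slot inv) vtJ public
      y∉B : y ∉ B
      y∉B = slot-unqueued inv (suc d) y vtJ
      y∈B′ : y ∈ B ++ y ∷ []
      y∈B′ = ∈-snoc-last B y
      -- y now sits at the end of B, below slot j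
      transport : ∀ {x z} → PlacedBeforeB B (suc (suc d)) vt pos x z → PlacedBeforeB (B ++ y ∷ []) (suc (suc d)) vt′ pos x z
      transport {x} {z} (arr-arr px pz l) with x ≟V y | z ≟V y
      ... | yes refl | yes refl = ⊥-elim (<-irrefl refl l)
      ... | yes refl | no z≢y   = B-arr y∈B′ (still-placed pz z≢y) (subst (_< pos z) pos-y l)
      ... | no x≢y   | yes refl = arr-B (still-placed px x≢y) (m<n⇒m<1+n (subst (pos x <_) pos-y l)) y∈B′
      ... | no x≢y   | no z≢y   = arr-arr (still-placed px x≢y) (still-placed pz z≢y) l
      transport {x} (arr-B px l z∈B) with x ≟V y
      ... | yes refl = within-B (Precedes-last y z∈B)
      ... | no x≢y   = arr-B (still-placed px x≢y) l (∈-++⁺ˡ z∈B)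
      transport {z = z} (B-arr x∈B pz l) = B-arr (∈-++⁺ˡ x∈B) (still-placed pz z≢y) l
        where
        z≢y : ¬ z ≡ y
        z≢y refl = <-irrefl (sym pos-y) l
      transport (within-B z≺x) = within-B (Precedes-snoc y z≺x)

    invB-inject : ∀ {d B j vt pos y} → ReorderInvB (suc d) B j vt pos → vt (j ∸ 1) ≡ just y →
                  ReorderInvB (suc d) (B ++ y ∷ []) j (setVertex (j ∸ 1) nothing vt) pos
    invB-inject {d} {B} {j} {vt} {pos} {y} inv vtJ with 1+d≡j inv
    ... | refl = record
      { 1+d≡j            = refl
      ; j≤1+n            = j≤1+n inv
      ; B-gaps           = B-gaps′
      ; filled           = filled′
      ; pos-of-slot      = λ k x e → pos-of-slot inv k x (nonempty e)
      ; slot-unqueued    = λ k x e → [ slot-unqueued inv k x (nonempty e) , nonempty-≢y e ]′ ∘ ∈-snoc⁻ y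
      ; slot-range       = λ k x e → slot-range inv k x (nonempty e)
      ; placed-or-queued = placed-or-queued′
      ; B-unique         = allPairs-snoc y (B-unique inv) (λ x∈B x≡y → y∉B (subst (_∈ B) x≡y x∈B))
      ; order            = λ x z x→z → transport (order inv x z x→z)
      }
      where
      open InjectB inv vtJ
      B-gaps′ : nulls vt′ 1 (suc d) ≡ length (B ++ y ∷ [])
      B-gaps′ = begin
        nulls vt′ 1 (suc d)                 ≡⟨ nulls-snoc vt′ 1 d ⟩
        nulls vt′ 1 d + null? (vt′ (suc d)) ≡⟨ cong₂ _+_ (nulls-ext vt′ vt 1 d (λ k _ k<1+d → unchanged (<⇒≢ k<1+d)))
                                                          (cong null? (setVertex-here (suc d) nothing vt)) ⟩
        nulls vt 1 d + 1                    ≡⟨ +-comm (nulls vt 1 d) 1 ⟩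
        suc (nulls vt 1 d)                  ≡⟨ cong suc (sym (+-identityʳ (nulls vt 1 d))) ⟩
        suc (nulls vt 1 d + null? (just y)) ≡⟨ cong (λ z → suc (nulls vt 1 d + null? z)) (sym vtJ) ⟩
        suc (nulls vt 1 d + null? (vt (suc d))) ≡⟨ cong suc (sym (nulls-snoc vt 1 d)) ⟩
        suc (nulls vt 1 (suc d))            ≡⟨ cong suc (B-gaps inv) ⟩
        suc (length B)                      ≡⟨ sym (length-snoc B y) ⟩
        length (B ++ y ∷ [])                ∎
        where open ≡-Reasoning
      filled′ : ∀ k → suc (suc d) ≤ k → k ≤ n → ∃[ x ] vt′ k ≡ just x
      filled′ k j≤k k≤n with filled inv k j≤k k≤n
      ... | x , vtk = x , trans (unchanged (>⇒≢ j≤k)) vtk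
      placed-or-queued′ : ∀ x → Placed vt′ pos x ⊎ x ∈ B ++ y ∷ []
      placed-or-queued′ x with x ≟V y | placed-or-queued inv x
      ... | yes refl | _       = inj₂ y∈B′
      ... | no x≢y   | inj₁ px  = inj₁ (still-placed px x≢y)
      ... | no _     | inj₂ x∈B = inj₂ (∈-++⁺ˡ x∈B)

    invB-skip : ∀ {d B j vt pos y} → ReorderInvB (suc d) B j vt pos → vt (j ∸ 1) ≡ just y →
                any (λ z → G y z) B ≡ false → ReorderInvB d B (j ∸ 1) vt pos
    invB-skip {d} {B} {j} {vt} {pos} {y} inv vtJ noArc with 1+d≡j inv
    ... | refl = record
      { 1+d≡j            = refl
      ; j≤1+n            = ≤-trans (n≤1+n (suc d)) (j≤1+n inv)
      ; B-gaps           = trans (sym (+-identityʳ (nulls vt 1 d)))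
                                 (trans (cong (λ z → nulls vt 1 d + null? z) (sym vtJ))
                                        (trans (sym (nulls-snoc vt 1 d)) (B-gaps inv)))
      ; filled           = filled′
      ; pos-of-slot      = pos-of-slot inv
      ; slot-unqueued    = slot-unqueued inv
      ; slot-range       = slot-range inv
      ; placed-or-queued = placed-or-queued inv
      ; B-unique         = B-unique inv
      ; order            = λ x z x→z → transport x→z (order inv x z x→z)
      }
      where
      filled′ : ∀ k → suc d ≤ k → k ≤ n → ∃[ x ] vt k ≡ just x
      filled′ k J≤k k≤n with k ≟ suc d
      ... | yes refl = y , vtJ
      ... | no k≢J   = filled inv k (≤∧≢⇒< J≤k (λ e → k≢J (sym e))) k≤n
      -- only an arc from y into B could be affected, and there is none
      transport : ∀ {x z} → Arc G x z → PlacedBeforeB B (suc (suc d)) vt pos x z → PlacedBeforeB B (suc d) vt pos x z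
      transport _ (arr-arr px pz l) = arr-arr px pz l
      transport {x} x→z (arr-B px l z∈B) with pos x ≟ suc d
      ... | yes px≡J with just-injective (trans (sym px) (trans (cong vt px≡J) vtJ))
      ...   | refl = ⊥-elim (any-false (λ z → G y z) B noArc z∈B x→z)
      transport _ (arr-B px l z∈B) | no px≢J = arr-B px (≤∧≢⇒< (≤-pred l) px≢J) z∈B
      transport _ (B-arr x∈B pz l) = B-arr x∈B pz (<⇒≤ l)
      transport _ (within-B z≺x)   = within-B z≺x

    invB-done : ∀ {d j vt pos} → ReorderInvB d [] j vt pos → IsNumbering n pos vt × Topological G pos
    invB-done {d} {j} {vt} {pos} inv = (range , onto , injective , inverse) , sorted
      where
      placed : ∀ x → Placed vt pos x
      placed x with placed-or-queued inv x
      ... | inj₁ px = px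
      ... | inj₂ ()
      range : ∀ x → 1 ≤ pos x × pos x ≤ n
      range x = slot-range inv (pos x) x (placed x)
      full : ∀ k → 1 ≤ k → k ≤ n → ∃[ x ] vt k ≡ just x
      full k 1≤k k≤n with k <? j
      ... | yes k<j = nulls-zero vt 1 d (B-gaps inv) k 1≤k (subst (k <_) (sym (1+d≡j inv)) k<j)
      ... | no k≮j  = filled inv k (≮⇒≥ k≮j) k≤n
      onto : ∀ k → 1 ≤ k → k ≤ n → ∃[ x ] pos x ≡ k
      onto k 1≤k k≤n with full k 1≤k k≤n
      ... | x , vtk = x , pos-of-slot inv k x vtk
      injective : ∀ x y → pos x ≡ pos y → x ≡ y
      injective x y e = just-injective (trans (sym (placed x)) (trans (cong vt e) (placed y)))
      inverse : ∀ k x → (vt k ≡ just x → pos x ≡ k) × (pos x ≡ k → vt k ≡ just x)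
      inverse k x = pos-of-slot inv k x , (λ e → subst (λ z → vt z ≡ just x) e (placed x))
      sorted : Topological G pos
      sorted x y x→y with order inv x y x→y
      ... | arr-arr _ _ l = l
      ... | arr-B _ _ ()
      ... | B-arr () _ _
      ... | within-B y≺x with Precedes-∈ˡ y≺x
      ...   | ()

    invF⇒invB : ∀ {d B i vt pos} → (inv : ReorderInvF d [] B i vt pos) → ReorderInvB (ReorderInvF.dB inv) B m vt pos
    invF⇒invB {d} {B} {i} {vt} {pos} inv = record
      { 1+d≡j            = ReorderInvF.1+dB≡m inv
      ; j≤1+n            = ≤-trans (ReorderInvF.m≤i inv) (subst (i ≤_) (ReorderInvF.i+dF≡1+n inv) (m≤m+n i d))
      ; B-gaps           = ReorderInvF.B-gaps inv
      ; filled           = filled′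
      ; pos-of-slot      = ReorderInvF.pos-of-slot inv
      ; slot-unqueued    = λ k x e → proj₂ (ReorderInvF.slot-unqueued inv k x e)
      ; slot-range       = ReorderInvF.slot-range inv
      ; placed-or-queued = placed-or-queued′
      ; B-unique         = ReorderInvF.B-unique inv
      ; order            = λ x y x→y → transport (ReorderInvF.order inv x y x→y)
      }
      where
      -- no gaps remain above i, so all slots from m on are filled
      filled′ : ∀ k → m ≤ k → k ≤ n → ∃[ x ] vt k ≡ just x
      filled′ k m≤k k≤n with k <? i
      ... | yes k<i = ReorderInvF.filled inv k m≤k k<i
      ... | no k≮i  = nulls-zero vt i d (ReorderInvF.F-gaps inv) k (≮⇒≥ k≮i)
                        (subst (k <_) (sym (ReorderInvF.i+dF≡1+n inv)) (s≤s k≤n))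
      placed-or-queued′ : ∀ x → Placed vt pos x ⊎ x ∈ B
      placed-or-queued′ x with ReorderInvF.placed-or-queued inv x
      ... | inj₁ px         = inj₁ px
      ... | inj₂ (inj₁ ())
      ... | inj₂ (inj₂ x∈B) = inj₂ x∈B
      transport : ∀ {x y} → PlacedBeforeF [] B i vt pos x y → PlacedBeforeB B m vt pos x y
      transport (arr-arr px py l) = arr-arr px py l
      transport (arr-B px l y∈B)  = arr-B px l y∈B
      transport (B-arr x∈B py l)  = B-arr x∈B py l
      transport (arr-F _ _ ())
      transport (F-arr () _ _)
      transport (B-F _ ())
      transport (within-B y≺x)    = within-B y≺x
      transport (within-F x≺y) with Precedes-∈ˡ x≺y
      ... | ()

    runLoopB : ∀ d B i j vt pos → ReorderInvB d B j vt pos →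
               ∃[ f ] ∃[ s ] (loopB f (st [] B i j vt pos) ≡ just s × NumberedTopologically s)
    runLoopB d [] i j vt pos inv = 1 , _ , refl , invB-done inv
    runLoopB zero (b ∷ q) i j vt pos inv with B-gaps inv
    ... | ()
    runLoopB (suc d) (b ∷ q) i j vt pos inv with vt (j ∸ 1) in vtJ
    ... | nothing with runLoopB d q i (j ∸ 1) _ _ (invB-pop inv vtJ)
    ...   | f , s , run , done = suc f , s , trans (cong (loopB f) (St-ext (stepB-pop b q [] i j vt pos vtJ))) run , done
    runLoopB (suc d) (b ∷ q) i j vt pos inv | just y with any (λ z → G y z) (b ∷ q) in arc
    ... | true with runLoopB d (q ++ y ∷ []) i (j ∸ 1) _ _ (invB-pop (invB-inject inv vtJ) (setVertex-here (j ∸ 1) nothing vt))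
    ...   | f , s , run , done = suc f , s , trans (cong (loopB f) (St-ext (stepB-inject b q [] i j vt pos y vtJ arc))) run , done
    runLoopB (suc d) (b ∷ q) i j vt pos inv | just y | false with runLoopB d (b ∷ q) i (j ∸ 1) _ _ (invB-skip inv vtJ arc)
    ...   | f , s , run , done = suc f , s , trans (cong (loopB f) (St-ext (stepB-skip b q [] i j vt pos y vtJ arc))) run , done

    runLoopF : ∀ d F B i vt pos → ReorderInvF d F B i vt pos →
               ∃[ f ] ∃[ s ] (loopF f (st F B i m vt pos) ≡ just s × NumberedTopologically s)
    runLoopF d [] B i vt pos inv with runLoopB (ReorderInvF.dB inv) B i m vt pos (invF⇒invB inv)
    ... | f , s , run , done = suc f , s , run , done
    runLoopF zero (f₀ ∷ q) B i vt pos inv with ReorderInvF.F-gaps inv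
    ... | ()
    runLoopF (suc d) (f₀ ∷ q) B i vt pos inv with vt i in vti
    ... | nothing with runLoopF d q B (suc i) _ _ (invF-pop inv vti)
    ...   | f , s , run , done = suc f , s , trans (cong (loopF f) (St-ext (stepF-pop f₀ q B i m vt pos vti))) run , done
    runLoopF (suc d) (f₀ ∷ q) B i vt pos inv | just y with any (λ u → G u y) (f₀ ∷ q) in arc
    ... | true with runLoopF d (q ++ y ∷ []) B (suc i) _ _ (invF-pop (invF-inject inv vti) (setVertex-here i nothing vt))
    ...   | f , s , run , done = suc f , s , trans (cong (loopF f) (St-ext (stepF-inject f₀ q B i m vt pos y vti arc))) run , done
    runLoopF (suc d) (f₀ ∷ q) B i vt pos inv | just y | false with runLoopF d (f₀ ∷ q) B (suc i) _ _ (invF-skip inv vti arc)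
    ...   | f , s , run , done = suc f , s , trans (cong (loopF f) (St-ext (stepF-skip f₀ q B i m vt pos y vti arc))) run , done

  F<B : ∀ {lo hi F B vt x y} → SearchInv lo hi F B vt → x ∈ F → y ∈ B → p x < p y
  F<B inv x∈F y∈B = <-≤-trans (F-below inv x∈F) (≤-trans (lo≤hi inv) (B-above inv y∈B))

  F∩B≡∅ : ∀ {lo hi F B vt x} → SearchInv lo hi F B vt → x ∈ F → x ∈ B → ⊥
  F∩B≡∅ inv x∈F x∈B = <-irrefl refl (F<B inv x∈F x∈B)

  F⇒≢v : ∀ {lo hi F B vt x} → SearchInv lo hi F B vt → x ∈ F → ¬ x ≡ v
  F⇒≢v inv x∈F refl = F∩B≡∅ inv x∈F (v∈B inv)

  ∉B⇒≢v : ∀ {lo hi F B vt x} → SearchInv lo hi F B vt → x ∉ B → ¬ x ≡ v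
  ∉B⇒≢v inv x∉B refl = x∉B (v∈B inv)

  ∉F⇒≢w : ∀ {lo hi F B vt x} → SearchInv lo hi F B vt → x ∉ F → ¬ x ≡ w
  ∉F⇒≢w inv x∉F refl = x∉F (w∈F inv)

  -- If the cycle test finds an arc (u , z) with u ∈ F and z ∈ B, then
  -- w ⇝ u → z ⇝ v → w is a cycle of G.
  F-B-arc⇒cycle : ∀ {lo hi F B vt} → SearchInv lo hi F B vt → any (λ u → arcTo u B) F ≡ true → Cyclic G
  F-B-arc⇒cycle {F = F} {B} inv test with any-true (λ u → arcTo u B) F test
  ... | u , u∈F , u→B with any-true (λ z → G u z) B u→B
  ... | z , z∈B , u→z = w , path-then-arc (F-from-w inv u∈F ◅◅ (u→z ◅ B-to-v inv z∈B)) arc-vw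

  no-F-B-arc : ∀ {F B} → any (λ u → arcTo u B) F ≡ false → ∀ {u z} → u ∈ F → z ∈ B → ¬ Arc G u z
  no-F-B-arc {F} {B} test u∈F z∈B u→z =
    any-false (λ u → arcTo u B) F test u∈F (any-intro (λ z → G _ z) B z∈B u→z)

  cycleTest-sound : ∀ {s} → Stopped s → cycleTest s ≡ true → Cyclic G
  cycleTest-sound (stopped _ _ _ _ refl (inj₁ (inv , _))) test = F-B-arc⇒cycle inv test
  cycleTest-sound (stopped _ _ _ _ refl (inj₂ (inv , _))) test = F-B-arc⇒cycle inv test

  module ReorderStart (m : ℕ) where
    open Reordering m
    open DecMembership (_≟F_ {n}) using (_∈?_)

    initialOrder : ∀ {lo F B vt} → SearchInv lo lo F B vt → m ≤ lo →
                   (∀ x → vt (p x) ≡ just x → p x < lo → p x < m) →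
                   (∀ {u z} → u ∈ F → z ∈ B → ¬ Arc G u z) →
                   ∀ x y → Arc G x y → PlacedBeforeF F B m vt p x y
    initialOrder {lo} {F} {B} {vt} inv m≤lo below-m noArc x y x→y = cases (x ∈? F) (x ∈? B) (y ∈? F) (y ∈? B)
      where
      placed : ∀ {z} → z ∉ F → z ∉ B → Placed vt p z
      placed = in-place inv _
      cases : Dec (x ∈ F) → Dec (x ∈ B) → Dec (y ∈ F) → Dec (y ∈ B) → PlacedBeforeF F B m vt p x y
      cases (yes x∈F) _ (yes y∈F) _ with Precedes-trichotomy x∈F y∈F
      ... | inj₁ refl           = ⊥-elim (arc-irrefl x→y)
      ... | inj₂ (inj₁ x≺y)    = within-F x≺y
      ... | inj₂ (inj₂ y≺x)    =
        ⊥-elim (<-asym (AllPairs-Precedes (F-sorted inv) y≺x) (p-mono-¬v x→y (F⇒≢v inv x∈F)))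
      cases (yes x∈F) _ (no _) (yes y∈B) = ⊥-elim (noArc x∈F y∈B x→y)
      cases (yes x∈F) _ (no y∉F) (no y∉B) with p y <? lo
      ... | yes py<lo = ⊥-elim (y∉F (F-closed inv y x∈F x→y py<lo))
      ... | no  py≮lo = F-arr x∈F (placed y∉F y∉B) (≤-trans m≤lo (≮⇒≥ py≮lo))
      cases (no _) (yes x∈B) (yes y∈F) _ = B-F x∈B y∈F
      cases (no _) (yes x∈B) (no y∉F) (yes y∈B) with Precedes-trichotomy x∈B y∈B
      ... | inj₁ refl           = ⊥-elim (arc-irrefl x→y)
      ... | inj₂ (inj₁ x≺y)    =
        ⊥-elim (<-asym (AllPairs-Precedes (B-sorted inv) x≺y) (p-mono-¬w x→y (∉F⇒≢w inv y∉F)))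
      ... | inj₂ (inj₂ y≺x)    = within-B y≺x
      cases (no _) (yes x∈B) (no y∉F) (no y∉B) =
        B-arr x∈B (placed y∉F y∉B)
          (<⇒≤ (≤-<-trans (≤-trans m≤lo (B-above inv x∈B)) (p-mono-¬w x→y (∉F⇒≢w inv y∉F))))
      cases (no x∉F) (no x∉B) (yes y∈F) _ =
        arr-F (placed x∉F x∉B)
          (below-m x (placed x∉F x∉B) (<-trans (p-mono-¬v x→y (∉B⇒≢v inv x∉B)) (F-below inv y∈F))) y∈F
      cases (no x∉F) (no x∉B) (no _) (yes y∈B) with p x <? lo
      ... | yes px<lo = arr-B (placed x∉F x∉B) (below-m x (placed x∉F x∉B) px<lo) y∈B
      ... | no  px≮lo = ⊥-elim (x∉B (B-closed inv x y∈B x→y (≮⇒≥ px≮lo)))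
      cases (no x∉F) (no x∉B) (no y∉F) (no y∉B) =
        arr-arr (placed x∉F x∉B) (placed y∉F y∉B) (p-mono-¬v x→y (∉B⇒≢v inv x∉B))

    initialInvF : ∀ {lo F B vt} → (inv : SearchInv lo lo F B vt) → m ≤ lo →
                  (∀ x → vt (p x) ≡ just x → p x < lo → p x < m) →
                  (∀ {u z} → u ∈ F → z ∈ B → ¬ Arc G u z) →
                  ∀ dF → m + dF ≡ suc n → nulls vt m dF ≡ length F →
                  ∀ dB → 1 + dB ≡ m → nulls vt 1 dB ≡ length B →
                  ReorderInvF dF F B m vt p
    initialInvF {lo} {F} {B} {vt} inv m≤lo below-m noArc dF m+dF dF-nulls dB 1+dB dB-nulls = record
      { m≤i              = ≤-refl
      ; 1≤m              = subst (1 ≤_) 1+dB (s≤s z≤n)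
      ; i+dF≡1+n         = m+dF
      ; F-gaps           = dF-nulls
      ; dB               = dB
      ; 1+dB≡m           = 1+dB
      ; B-gaps           = dB-nulls
      ; filled           = λ k m≤k k<m → ⊥-elim (<-irrefl refl (<-≤-trans k<m m≤k))
      ; pos-of-slot      = λ k x e → vx⇒p k x (from-initial inv k x e)
      ; slot-unqueued    = unqueued inv
      ; slot-range       = λ k x e → subst (λ z → 1 ≤ z × z ≤ n) (vx⇒p k x (from-initial inv k x e)) (p-range x)
      ; placed-or-queued = placed-or-queued′
      ; F-unique         = AllPairs.map (λ px<py e → <-irrefl (cong p e) px<py) (F-sorted inv)
      ; B-unique         = AllPairs.map (λ py<px e → <-irrefl (cong p (sym e)) py<px) (B-sorted inv)
      ; FB-disjoint      = F∩B≡∅ inv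
      ; order            = initialOrder inv m≤lo below-m noArc
      }
      where
      placed-or-queued′ : ∀ x → Placed vt p x ⊎ x ∈ F ⊎ x ∈ B
      placed-or-queued′ x with x ∈? F | x ∈? B
      ... | yes x∈F | _       = inj₂ (inj₁ x∈F)
      ... | no _    | yes x∈B = inj₂ (inj₂ x∈B)
      ... | no x∉F  | no x∉B  = inj₁ (in-place inv x x∉F x∉B)

    startAfterI : ∀ {F B vt} (inv : SearchInv m m F B vt) → length F ≡ length B →
                  (∀ {u z} → u ∈ F → z ∈ B → ¬ Arc G u z) → ReorderInvF (above inv) F B m vt p
    startAfterI {F} {B} {vt} inv len noArc =
      initialInvF inv ≤-refl (λ _ _ px<m → px<m) noArc
        (above inv) (above-eq inv) (trans (B-nulls inv) (sym len))
        (below inv) (below-eq inv) (trans (F-nulls inv) len)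

    startAfterJ : ∀ {F B vt} (inv : SearchInv (suc m) (suc m) F B vt) → length F ≡ suc (length B) →
                  vt m ≡ nothing → (∀ {u z} → u ∈ F → z ∈ B → ¬ Arc G u z) →
                  ReorderInvF (suc (above inv)) F B m vt p
    startAfterJ {F} {B} {vt} inv len vtm noArc =
      initialInvF inv (n≤1+n m) below-m noArc
        (suc (above inv)) (trans (+-suc m (above inv)) (above-eq inv))
        (trans (cong (λ z → null? z + nulls vt (suc m) (above inv)) vtm) (trans (cong suc (B-nulls inv)) (sym len)))
        d 1+d≡m B-gaps′
      where
      -- the B-loop starts below slot m, and m ≥ 1 since p w ≤ m
      d : ℕ
      d = m ∸ 1
      1+d≡m : 1 + d ≡ m
      1+d≡m = suc-∸1 (<-≤-trans (proj₁ (p-range w)) (≤-pred (F-below inv (w∈F inv))))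
      below≡m : below inv ≡ m
      below≡m = suc-injective (below-eq inv)
      -- slot m is null, so a placed vertex below suc m lies below m
      below-m : ∀ x → vt (p x) ≡ just x → p x < suc m → p x < m
      below-m x placed px<1+m = ≤∧≢⇒< (≤-pred px<1+m) (λ px≡m → just≢nothing (trans (sym placed) (trans (cong vt px≡m) vtm)))
      B-gaps′ : nulls vt 1 d ≡ length B
      B-gaps′ = suc-injective (begin
        suc (nulls vt 1 d)                ≡⟨ +-comm 1 (nulls vt 1 d) ⟩
        nulls vt 1 d + 1                  ≡⟨ cong (λ z → nulls vt 1 d + null? z) (sym vtm) ⟩
        nulls vt 1 d + null? (vt m)       ≡⟨ cong (λ k → nulls vt 1 d + null? (vt k)) (sym 1+d≡m) ⟩
        nulls vt 1 d + null? (vt (1 + d)) ≡⟨ sym (nulls-snoc vt 1 d) ⟩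
        nulls vt 1 (suc d)                ≡⟨ cong (nulls vt 1) (trans 1+d≡m (sym below≡m)) ⟩
        nulls vt 1 (below inv)            ≡⟨ F-nulls inv ⟩
        length F                          ≡⟨ len ⟩
        suc (length B)                    ∎)
        where
        open ≡-Reasoning

  ReorderSucceeds : St n → Set
  ReorderSucceeds s = ∃[ k′ ] ∃[ s′ ] (reorder k′ s ≡ just s′ × NumberedTopologically s′)

  reorderSucceeds : ∀ {s} → Stopped s → cycleTest s ≡ false → ReorderSucceeds s
  reorderSucceeds (stopped F B m vt refl (inj₁ (inv , len))) test =
    Reordering.runLoopF m (above inv) F B m vt p (ReorderStart.startAfterI m inv len (no-F-B-arc test))
  reorderSucceeds (stopped F B m vt refl (inj₂ (inv , len , vtm))) test =
    Reordering.runLoopF m (suc (above inv)) F B m vt p (ReorderStart.startAfterJ m inv len vtm (no-F-B-arc test))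

  stoppedCorrect : ∀ {s} → Stopped s → ((cycleTest s ≡ true) ⇔ Cyclic G) × (¬ Cyclic G → ReorderSucceeds s)
  stoppedCorrect {s} stop with cycleTest s in test
  ... | true  = mk⇔ (λ _ → cycleTest-sound stop test) (λ _ → refl)
              , (λ acyclic → ⊥-elim (acyclic (cycleTest-sound stop test)))
  ... | false with reorderSucceeds stop test
  ...   | k′ , s′ , reordered , numbering , sorted =
    mk⇔ (λ ()) (λ cyclic → ⊥-elim (topological⇒acyclic G _ sorted cyclic))
    , (λ _ → k′ , s′ , reordered , numbering , sorted)

-- The search stops; at the stopped state the cycle test is exact, and if
-- it finds no cycle the reordering yields a topological numbering.
theorem5p1 : (n : ℕ) (A : Adj n) (position : Fin n → ℕ) (vertex : ℕ → Maybe (Fin n)) (v w : Fin n) →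
    IsNumbering n position vertex →
    Acyclic A →
    Topological A position →
    position w < position v →
    ∃[ k ] ∃[ s ]
      ( Algorithm.search (addArc A v w) k v w position vertex ≡ just s
      × ((Algorithm.cycleTest (addArc A v w) s ≡ true) ⇔ Cyclic (addArc A v w))
      × (¬ Cyclic (addArc A v w) →
          ∃[ k′ ] ∃[ s′ ]
            ( Algorithm.reorder (addArc A v w) k′ s ≡ just s′
            × IsNumbering n (St.position s′) (St.vertex s′)
            × Topological (addArc A v w) (St.position s′))))
theorem5p1 n A p vx v w isN _ topo wv =
  let open Correctness A v w p vx isN topo wv
      (k , s , run , stop) = searchStops
  in k , s , run , stoppedCorrect stop
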